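{- Let $G$ be an Eulerian solid subgraph of the triangular lattice with $f$ bounded faces. Consider the tower-moves chain on $EO(G)$ with $p_T=\frac{1}{3h}$ for every tower of length $h$. Let $\sigma_1,\sigma_2\in EO(G)$ be such that $\sigma_2$ is obtained from $\sigma_1$ by reversing a single directed bounded face $A$, and consider the coupling described below started from $(\sigma_1,\sigma_2)$. Suppose $B$ is a bounded face sharing an edge with $A$ that is directed in neither $\sigma_1$ nor $\sigma_2$. Then $\mathbb{E}[\delta_{B}] \le \frac{1}{3f}$.
   Context: Triangular lattice: vertices $v_{i,j}$ ($i,j\in\mathbb{Z}$), edges $\{v_{i,j},v_{i+1,j}\}$, $\{v_{i,j},v_{i,j+1}\}$, $\{v_{i,j},v_{i+1,j-1}\}$, standard planar embedding with triangular bounded faces. A solid subgraph is a cycle of the lattice together with everything in its interior; Eulerian means all degrees even. $EO(G)$ is the set of Eulerian orientations (in-degree = out-degree at every vertex). A bounded face is directed if its boundary edges form a directed cycle; almost-directed if all but one boundary edge share a common direction around the face, the exceptional edge being the blocking edge. A tower of length $h$ starting at $F_1$ is a sequence of faces $F_1,\dots,F_h$, consecutive ones sharing an edge, with $F_i$ ($i<h$) almost-directed with blocking edge shared with $F_{i+1}$, and $F_h$ directed. Reversing the tower means reversing all edges of $\bigoplus_i E(F_i)$. Tower-moves chain: with probability $1/2$ stay; otherwise choose a bounded face $F$ uniformly; if $F$ is directed reverse it; else if there is a tower $T$ of length $h$ starting at $F$, reverse it with probability $p_T=1/(3h)$; else stay. Distance: $\delta(\sigma,\sigma')$ is the shortest-path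 distance in the graph on $EO(G)$ whose edges join orientations differing by the reversal of a single directed face. Coupling from $(\sigma_1,\sigma_2)$: with probability $1/2-1/(2f)$ both chains stay; with probability $1/(2f)$ chain 1 moves using face $A$ and chain 2 stays; with probability $1/(2f)$ chain 2 moves using face $A$ and chain 1 stays; for each bounded face $F\ne A$, with probability $1/(2f)$ both chains attempt to move using $F$, where the tower-reversal coin flips are coupled so that both chains perform their respective moves with probability equal to the minimum of their individual move probabilities. The move at a face $F$ involves face $B$ if $F=B$ or there is a tower starting at $F$ that contains $B$. $\delta_B$ denotes the contribution to $\delta(X_{t+1},Y_{t+1})-\delta(X_t,Y_t)$ coming from selections of faces $F\neq A$ whose move involves $B$ in at least one of the two chains; $\mathbb{E}[\delta_B]$ is its expectation over one step of the coupling. -}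

module Defs where

open import Data.Bool using (Bool; true; false; not; _xor_; _∨_; if_then_else_)
open import Data.Nat as ℕ using (ℕ; zero; suc; _%_)
open import Data.Nat.Divisibility using (_∣_)
open import Data.Integer as ℤ using (ℤ; +_; _≤ᵇ_)
open import Data.Rational as ℚ using (ℚ; 0ℚ; 1ℚ; _⊓_)
open import Data.Product using (_×_; _,_; proj₁; proj₂)
open import Data.Product.Properties using (≡-dec)
open import Data.List using (List; []; _∷_; _++_; length; filter; foldr; concatMap; deduplicate; zip; mapMaybe; any; map)
open import Data.List.Relation.Unary.All using (All)
open import Data.List.Relation.Unary.Unique.Propositional using (Unique)
open import Data.List.Membership.Propositional using (_∈_)
open import Data.List.Membership.DecPropositional using () renaming (_∈?_ to memDec)
open import Data.Maybe using (Maybe; just; nothing; Is-just)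
import Data.Maybe as Maybe
open import Relation.Binary.PropositionalEquality using (_≡_; refl; cong; cong₂)
open import Relation.Binary.Definitions using (DecidableEquality)
open import Relation.Nullary using (Dec; yes; no; does; ¬_)
open import Function.Bundles using (_⇔_)

-- The triangular lattice.
-- Vertex v_{i,j} is the pair (i , j).  Planar embedding:
-- v_{i,j} ↦ i·(1,0) + j·(1/2, √3/2).

V : Set
V = ℤ × ℤ

_≟V_ : DecidableEquality V
_≟V_ = ≡-dec ℤ._≟_ ℤ._≟_

data Dir : Set where
  d0 d1 d2 : Dir

_≟D_ : DecidableEquality Dir
d0 ≟D d0 = yes refl
d1 ≟D d1 = yes refl
d2 ≟D d2 = yes refl
d0 ≟D d1 = no λ ()
d0 ≟D d2 = no λ ()
d1 ≟D d0 = no λ ()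
d1 ≟D d2 = no λ ()
d2 ≟D d0 = no λ ()
d2 ≟D d1 = no λ ()

step : Dir → V
step d0 = (+ 1 , + 0)
step d1 = (+ 0 , + 1)
step d2 = (+ 1 , ℤ.- (+ 1))

_⊕_ : V → V → V
(a , b) ⊕ (c , d) = (a ℤ.+ c , b ℤ.+ d)

-- An (undirected) lattice edge, represented canonically as
-- (v , d) = the edge {v , v ⊕ step d}.
Edge : Set
Edge = V × Dir

_≟E_ : DecidableEquality Edge
_≟E_ = ≡-dec _≟V_ _≟D_

tailE headE : Edge → V
tailE (v , d) = v
headE (v , d) = v ⊕ step d

edgeBetween : V → V → Maybe Edge
edgeBetween u w = go (d0 ∷ d1 ∷ d2 ∷ [])
  where
  go : List Dir → Maybe Edge
  go [] = nothing
  go (d ∷ ds) with (u ⊕ step d) ≟V w | (w ⊕ step d) ≟V u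
  ... | yes _ | _     = just (u , d)
  ... | no _  | yes _ = just (w , d)
  ... | no _  | no _  = go ds

-- Orientations: σ e = true means e is oriented tailE e → headE e.
-- (Only the values on edges of G are meaningful; see Agree below.)
Ori : Set
Ori = Edge → Bool

srcσ dstσ : Ori → Edge → V
srcσ σ e = if σ e then tailE e else headE e
dstσ σ e = if σ e then headE e else tailE e

-- Bounded faces (triangles) of the lattice.
-- up v    : triangle v , v+(1,0) , v+(0,1)
-- down v  : triangle v+(1,0) , v+(0,1) , v+(1,1)

data Face : Set where
  up down : V → Face

_≟F_ : DecidableEquality Face
up v ≟F up w with v ≟V w
... | yes refl = yes refl
... | no ne = no λ { refl → ne refl }
down v ≟F down w with v ≟V w
... | yes refl = yes refl
... | no ne = no λ { refl → ne refl }
up v ≟F down w = no λ ()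
down v ≟F up w = no λ ()

-- A side of a face: an edge together with a flag telling whether the
-- canonical direction tailE → headE of the edge agrees with the
-- counterclockwise traversal of the face boundary.
Side : Set
Side = Edge × Bool

sides : Face → Side × Side × Side
sides (up (i , j)) =
  ( ((i , j) , d0) , true ) ,
  ( ((i , j ℤ.+ + 1) , d2) , false ) ,
  ( ((i , j) , d1) , false )
sides (down (i , j)) =
  ( ((i ℤ.+ + 1 , j) , d1) , true ) ,
  ( ((i , j ℤ.+ + 1) , d0) , false ) ,
  ( ((i , j ℤ.+ + 1) , d2) , true )

faceEdges : Face → List Edge
faceEdges F with sides F
... | (a , _) , (b , _) , (c , _) = a ∷ b ∷ c ∷ []

ccw : Ori → Side → Bool
ccw σ (e , s) = not (σ e xor s)

beq : Bool → Bool → Bool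
beq x y = not (x xor y)

isDirected : Ori → Face → Bool
isDirected σ F with sides F
... | a , b , c = beq (ccw σ a) (ccw σ b) Data.Bool.∧ beq (ccw σ b) (ccw σ c)
  where import Data.Bool

-- For a non-directed triangle (which is necessarily almost-directed:
-- exactly two sides share a direction around the face), the blocking
-- edge is the side whose direction differs from the other two.
blocking : Ori → Face → Edge
blocking σ F with sides F
... | (ea , sa) , (eb , sb) , (ec , sc) =
  if beq (ccw σ (ea , sa)) (ccw σ (eb , sb)) then ec
  else (if beq (ccw σ (ea , sa)) (ccw σ (ec , sc)) then eb else ea)

edgeFaces : Edge → Face × Face
edgeFaces ((i , j) , d0) = up (i , j) , down (i , j ℤ.- + 1)
edgeFaces ((i , j) , d1) = up (i , j) , down (i ℤ.- + 1 , j)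
edgeFaces ((i , j) , d2) = up (i , j ℤ.- + 1) , down (i , j ℤ.- + 1)

across : Face → Edge → Face
across F e with edgeFaces e
... | f₁ , f₂ with F ≟F f₁
...   | yes _ = f₂
...   | no _  = f₁

-- A cycle of the lattice is given by the cyclic list
-- of its (distinct, ≥ 3) vertices.  The bounded faces of the solid
-- subgraph are the lattice triangles in the interior of the cycle,
-- determined by the parity of crossings of a horizontal ray (direction
-- +(1,0)) from the centroid of the triangle with the cycle's edges.

cyclicPairs : List V → List (V × V)
cyclicPairs [] = []
cyclicPairs (v ∷ vs) = zip (v ∷ vs) (vs ++ (v ∷ []))

cycleEdges : List V → List Edge
cycleEdges C = mapMaybe (λ p → edgeBetween (proj₁ p) (proj₂ p)) (cyclicPairs C)

-- does the rightward horizontal ray from the centroid of F cross e ?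
-- centroid of up(i,j) = (i+1/3 , j+1/3), of down(i,j) = (i+2/3 , j+2/3)
crosses : Face → Edge → Bool
crosses F ((a , b) , d0) = false
crosses (up (i , j)) ((a , b) , d1) = isYes (b ℤ.≟ j) ∧ (i ℤ.+ + 1 ≤ᵇ a)
  where open import Data.Bool using (_∧_)
        open import Relation.Nullary.Decidable using (isYes)
crosses (down (i , j)) ((a , b) , d1) = isYes (b ℤ.≟ j) ∧ (i ℤ.+ + 1 ≤ᵇ a)
  where open import Data.Bool using (_∧_)
        open import Relation.Nullary.Decidable using (isYes)
crosses (up (i , j)) ((a , b) , d2) = isYes (b ℤ.≟ j ℤ.+ + 1) ∧ (i ≤ᵇ a)
  where open import Data.Bool using (_∧_)
        open import Relation.Nullary.Decidable using (isYes)
crosses (down (i , j)) ((a , b) , d2) = isYes (b ℤ.≟ j ℤ.+ + 1) ∧ (i ℤ.+ + 1 ≤ᵇ a)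
  where open import Data.Bool using (_∧_)
        open import Relation.Nullary.Decidable using (isYes)

crossCount : List V → Face → ℕ
crossCount C F = length (filter (λ e → T? (crosses F e)) (cycleEdges C))
  where open import Relation.Nullary.Decidable using (T?)

InsideCycle : List V → Face → Set
InsideCycle C F = crossCount C F % 2 ≡ 1

record IsCycle (C : List V) : Set where
  field
    long     : 3 ℕ.≤ length C
    distinct : Unique C
    adjacent : All (λ p → Is-just (edgeBetween (proj₁ p) (proj₂ p))) (cyclicPairs C)

record SolidFaces (C : List V) (fs : List Face) : Set where
  field
    cycle    : IsCycle C
    distinct : Unique fs
    exact    : ∀ F → (F ∈ fs) ⇔ InsideCycle C F

-- edges of G (every edge of a solid subgraph lies on a bounded face)
GEdges : List Face → List Edge
GEdges fs = deduplicate _≟E_ (concatMap faceEdges fs)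

deg : List Face → V → ℕ
deg fs v = length (filter (λ e → tailE e ≟V v) (GEdges fs))
         ℕ.+ length (filter (λ e → headE e ≟V v) (GEdges fs))

Eulerian : List Face → Set
Eulerian fs = ∀ v → 2 ∣ deg fs v

IsEO : List Face → Ori → Set
IsEO fs σ = ∀ v → length (filter (λ e → dstσ σ e ≟V v) (GEdges fs))
                ≡ length (filter (λ e → srcσ σ e ≟V v) (GEdges fs))

Agree : List Face → Ori → Ori → Set
Agree fs σ τ = ∀ e → e ∈ GEdges fs → σ e ≡ τ e

memB : {A : Set} → DecidableEquality A → A → List A → Bool
memB eq x xs = does (memDec eq x xs)

-- reverse all edges of the symmetric difference ⊕ E(F_i)
reverseFaces : List Face → Ori → Ori
reverseFaces Fs σ e = σ e xor foldr (λ F b → b xor memB _≟E_ e (faceEdges F)) false Fs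

-- The walk from F across blocking edges is deterministic and
-- stops at the first directed face; a tower visits distinct faces, so
-- length fs steps of fuel suffice.
towerGo : List Face → Ori → ℕ → Face → Maybe (List Face)
towerGo fs σ n F with memB _≟F_ F fs | isDirected σ F | n
... | false | _     | _     = nothing
... | true  | true  | _     = just (F ∷ [])
... | true  | false | zero  = nothing
... | true  | false | suc m = Maybe.map (F ∷_) (towerGo fs σ m (across F (blocking σ F)))

tower : List Face → Ori → Face → Maybe (List Face)
tower fs σ F = towerGo fs σ (length fs) F

-- 1/n as a rational (n ≥ 1 in all uses)
inv : ℕ → ℚ
inv zero = 0ℚ
inv (suc n) = (+ 1) ℚ./ suc n

-- the move at the selected bounded face F: (probability of moving,
-- resulting orientation); with the remaining probability the chain stays.
move : List Face → Ori → Face → ℚ × Ori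
move fs σ F with isDirected σ F | tower fs σ F
... | true  | _       = 1ℚ , reverseFaces (F ∷ []) σ
... | false | just T  = inv (3 ℕ.* length T) , reverseFaces T σ
... | false | nothing = 0ℚ , σ

involves : List Face → Ori → Face → Face → Bool
involves fs σ F B with F ≟F B | tower fs σ F
... | yes _ | _       = true
... | no _  | just T  = memB _≟F_ B T
... | no _  | nothing = false

data FlipPath (fs : List Face) : Ori → Ori → ℕ → Set where
  done : ∀ {σ τ} → Agree fs σ τ → FlipPath fs σ τ 0
  flip : ∀ {σ τ n} (F : Face) → F ∈ fs → isDirected σ F ≡ true →
         FlipPath fs (reverseFaces (F ∷ []) σ) τ n → FlipPath fs σ τ (suc n)

IsDistance : List Face → (Ori → Ori → ℕ) → Set
IsDistance fs d = ∀ σ τ → IsEO fs σ → IsEO fs τ →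
  FlipPath fs σ τ (d σ τ) × (∀ m → FlipPath fs σ τ m → d σ τ ℕ.≤ m)

-- expected change of δ when both chains attempt to move using F, with
-- the coin flips coupled maximally (both move w.p. min(p₁,p₂)).
pairContribution : List Face → (Ori → Ori → ℕ) → Ori → Ori → Face → ℚ
pairContribution fs d σ₁ σ₂ F with move fs σ₁ F | move fs σ₂ F
... | (p₁ , τ₁) | (p₂ , τ₂) =
      m ℚ.* (δ τ₁ τ₂ ℚ.- δ₀) ℚ.+ (p₁ ℚ.- m) ℚ.* (δ τ₁ σ₂ ℚ.- δ₀)
      ℚ.+ (p₂ ℚ.- m) ℚ.* (δ σ₁ τ₂ ℚ.- δ₀)
  where
  m = p₁ ⊓ p₂
  δ : Ori → Ori → ℚ
  δ x y = (+ d x y) ℚ./ 1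
  δ₀ = δ σ₁ σ₂

-- E[δ_B]: sum over bounded faces F ≠ A whose move involves B in at least
-- one chain, each selected with probability 1/(2f).
expectedδB : List Face → (Ori → Ori → ℕ) → Ori → Ori → Face → Face → ℚ
expectedδB fs d σ₁ σ₂ A B =
  foldr ℚ._+_ 0ℚ (map (λ F → inv (2 ℕ.* length fs) ℚ.* pairContribution fs d σ₁ σ₂ F)
                      (filter (λ F → T? (not (isYes (F ≟F A))
                                         Data.Bool.∧ (involves fs σ₁ F B ∨ involves fs σ₂ F B)))
                              fs))
  where import Data.Bool
        open import Relation.Nullary.Decidable using (T?; isYes)

{-# OPTIONS --safe #-}
module Submission where

-- Let e be the common side of A and B, and bᵢ the blocking side of B in σᵢ; then e, b₁, b₂ are the
-- three sides of B. In an Eulerian orientation no vertex has four consecutive spokes pointing the same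
-- way, which forces towers to go straight. Hence a tower of σ₁ through B is B's own tower or starts at
-- X₁ = across B b₂ blocked towards B, and symmetrically for σ₂ with X₂ = across B b₁. Reversing a
-- straight tower of length h amounts to h reversals of directed faces, so a move of one chain at a
-- non-directed face changes δ by at most h with probability 1/(3h), contributing at most 1/3.
-- If σ₁ blocks X₁ towards B, then in σ₂ the faces B and X₁ block each other and σ₂ cannot move at
-- either; otherwise X₁ is irrelevant. So σ₂ at B together with σ₁ at X₁ contributes at most 1/3,
-- likewise σ₁ at B with σ₂ at X₂, and E[δ_B] ≤ (1/2f)(1/3 + 1/3) = 1/(3f).

open import Defs
open import Data.Bool using (Bool; true; false; not; _xor_; _∧_; _∨_; T)
open import Data.Bool.Properties as BoolP
  using (not-involutive; not-injective; not-¬; xor-identityʳ; xor-same; xor-assoc)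
open import Data.Nat as ℕ using (ℕ; zero; suc; _+_; _*_; z≤n; s≤s)
import Data.Nat.Properties as ℕP
open import Data.Integer as ℤ using (ℤ; +_; -[1+_])
import Data.Integer.Properties as ℤP
open import Data.Rational as ℚ using (ℚ; 0ℚ; _⊓_; toℚᵘ; _≤_)
import Data.Rational.Properties as ℚP
open import Data.Rational.Unnormalised as ℚᵘ using (mkℚᵘ; *≡*; *≤*)
import Data.Rational.Unnormalised.Properties as ℚᵘP
open import Data.Rational.Solver using (module +-*-Solver)
open import Data.Integer.Tactic.RingSolver using (solve-∀)
open import Data.Nat.Tactic.RingSolver using () renaming (solve-∀ to ℕ-solve-∀)
open import Data.Product using (_×_; _,_; proj₁; proj₂; ∃)
open import Data.Sum using (_⊎_; inj₁; inj₂) renaming (map to ⊎-map)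
open import Data.Empty using (⊥; ⊥-elim)
open import Data.Unit using (⊤; tt)
open import Data.Maybe using (just; nothing)
open import Data.List using (List; []; _∷_; _++_; length; filter; map; foldr; concatMap)
open import Data.List.Properties using (length-++; length-++-sucʳ; length-map; filter-++; map-cong)
open import Data.List.Membership.Propositional using (_∈_; _∉_)
open import Data.List.Membership.Propositional.Properties
  using (∈-∃++; ∈-++⁺ˡ; ∈-++⁺ʳ; ∈-++⁻; ∈-filter⁺; ∈-filter⁻; ∈-deduplicate⁺; ∈-map⁺; ∈-map⁻)
open import Data.List.Membership.DecPropositional _≟E_ using () renaming (_∈?_ to _∈E?_)
open import Data.List.Membership.DecPropositional _≟F_ using () renaming (_∈?_ to _∈F?_)
open import Data.List.Relation.Binary.Subset.Propositional using (_⊆_)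
open import Data.List.Relation.Unary.Any using (here; there)
open import Data.List.Relation.Unary.All as All using (All; []; _∷_)
open import Data.List.Relation.Unary.AllPairs using ([]; _∷_)
open import Data.List.Relation.Unary.Unique.Propositional using (Unique)
import Data.List.Relation.Unary.Unique.Propositional.Properties as UniqueP
open import Data.List.Relation.Unary.Unique.DecPropositional.Properties _≟E_ using (deduplicate-!)
open import Relation.Binary.PropositionalEquality
open import Relation.Nullary using (Dec; yes; no; ¬_; ¬?)
open import Relation.Nullary.Decidable using (T?; isYes)
open import Function using (Equivalence)
open import Relation.Unary using (Pred; Decidable)
open import Level using (0ℓ)

module _ {A : Set} where

  ∈-++-∷⁻ : ∀ {x y : A} (ys zs : List A) → y ∈ ys ++ x ∷ zs → y ≢ x → y ∈ ys ++ zs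
  ∈-++-∷⁻ ys zs m y≢x with ∈-++⁻ ys m
  ... | inj₁ m₁ = ∈-++⁺ˡ m₁
  ... | inj₂ (here y≡x) = ⊥-elim (y≢x y≡x)
  ... | inj₂ (there m₂) = ∈-++⁺ʳ ys m₂

  Unique-⊆⇒length≤ : ∀ {xs ys : List A} → Unique xs → xs ⊆ ys → length xs ℕ.≤ length ys
  Unique-⊆⇒length≤ {[]} _ _ = z≤n
  Unique-⊆⇒length≤ {x ∷ xs} {ys} (x∉xs ∷ u) sub with ∈-∃++ (sub (here refl))
  ... | ys₁ , ys₂ , refl =
    ℕP.≤-trans (s≤s (Unique-⊆⇒length≤ u sub′)) (ℕP.≤-reflexive (sym (length-++-sucʳ ys₁ x ys₂)))
    where
    sub′ : xs ⊆ ys₁ ++ ys₂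
    sub′ m = ∈-++-∷⁻ ys₁ ys₂ (sub (there m)) (λ eq → All.lookup x∉xs m (sym eq))

  Unique-⊆⊇⇒length≡ : ∀ {xs ys : List A} → Unique xs → Unique ys → xs ⊆ ys → ys ⊆ xs →
                      length xs ≡ length ys
  Unique-⊆⊇⇒length≡ uxs uys sub sup =
    ℕP.≤-antisym (Unique-⊆⇒length≤ uxs sub) (Unique-⊆⇒length≤ uys sup)

  count : {P : Pred A 0ℓ} → Decidable P → List A → ℕ
  count P? xs = length (filter P? xs)

  count-cong : ∀ {P Q : Pred A 0ℓ} (P? : Decidable P) (Q? : Decidable Q) {xs ys} →
               Unique xs → Unique ys → (∀ {x} → x ∈ xs × P x → x ∈ ys × Q x) →
               (∀ {x} → x ∈ ys × Q x → x ∈ xs × P x) → count P? xs ≡ count Q? ys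
  count-cong P? Q? uxs uys to from =
    Unique-⊆⊇⇒length≡ (UniqueP.filter⁺ P? uxs) (UniqueP.filter⁺ Q? uys)
      (λ m → let (m′ , q) = to (∈-filter⁻ P? m) in ∈-filter⁺ Q? m′ q)
      (λ m → let (m′ , p) = from (∈-filter⁻ Q? m) in ∈-filter⁺ P? m′ p)

  count-split : ∀ {P Q : Pred A 0ℓ} (P? : Decidable P) (Q? : Decidable Q) xs →
                count P? xs ≡ count P? (filter Q? xs) + count P? (filter (λ x → ¬? (Q? x)) xs)
  count-split P? Q? [] = refl
  count-split P? Q? (x ∷ xs) with Q? x
  ... | yes _ with P? x
  ...   | yes _ = cong suc (count-split P? Q? xs)
  ...   | no _ = count-split P? Q? xs
  count-split P? Q? (x ∷ xs) | no _ with P? x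
  ...   | yes _ = trans (cong suc (count-split P? Q? xs)) (sym (ℕP.+-suc _ _))
  ...   | no _ = count-split P? Q? xs

m-1+1 : ∀ m → (m ℤ.- + 1) ℤ.+ + 1 ≡ m
m-1+1 = solve-∀

m+1-1 : ∀ m → (m ℤ.+ + 1) ℤ.- + 1 ≡ m
m+1-1 = solve-∀

m+1≢m : ∀ m → m ℤ.+ + 1 ≢ m
m+1≢m m eq with trans (sym (lem m)) (cong (ℤ._- m) eq)
  where
  lem : ∀ m → (m ℤ.+ + 1) ℤ.- m ≡ + 1
  lem = solve-∀
... | h rewrite ℤP.+-inverseʳ m with h
... | ()

upFace-cong : ∀ {i j i′ j′ : ℤ} → i ≡ i′ → j ≡ j′ → up (i , j) ≡ up (i′ , j′)
upFace-cong refl refl = refl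

downFace-cong : ∀ {i j i′ j′ : ℤ} → i ≡ i′ → j ≡ j′ → down (i , j) ≡ down (i′ , j′)
downFace-cong refl refl = refl

edge-cong : ∀ {i j i′ j′ : ℤ} {d : Dir} → i ≡ i′ → j ≡ j′ → ((i , j) , d) ≡ ((i′ , j′) , d)
edge-cong refl refl = refl

isUp : Face → Bool
isUp (up _) = true
isUp (down _) = false

upOf downOf : Edge → Face
upOf e = proj₁ (edgeFaces e)
downOf e = proj₂ (edgeFaces e)

isUp-upOf : ∀ e → isUp (upOf e) ≡ true
isUp-upOf (_ , d0) = refl
isUp-upOf (_ , d1) = refl
isUp-upOf (_ , d2) = refl

isUp-downOf : ∀ e → isUp (downOf e) ≡ false
isUp-downOf (_ , d0) = refl
isUp-downOf (_ , d1) = refl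
isUp-downOf (_ , d2) = refl

upOf≢downOf : ∀ e → downOf e ≢ upOf e
upOf≢downOf e eq = not-¬ (isUp-downOf e) (trans (cong isUp eq) (isUp-upOf e))

across-upOf : ∀ e → across (upOf e) e ≡ downOf e
across-upOf e with upOf e ≟F upOf e
... | yes _ = refl
... | no ne = ⊥-elim (ne refl)

across-downOf : ∀ e → across (downOf e) e ≡ upOf e
across-downOf e with downOf e ≟F upOf e
... | yes eq = ⊥-elim (upOf≢downOf e eq)
... | no _ = refl

∈faceEdges⇒upOf⊎downOf : ∀ F {e} → e ∈ faceEdges F → F ≡ upOf e ⊎ F ≡ downOf e
∈faceEdges⇒upOf⊎downOf (up (i , j)) (here refl) = inj₁ refl
∈faceEdges⇒upOf⊎downOf (up (i , j)) (there (here refl)) = inj₁ (upFace-cong refl (sym (m+1-1 j)))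
∈faceEdges⇒upOf⊎downOf (up (i , j)) (there (there (here refl))) = inj₁ refl
∈faceEdges⇒upOf⊎downOf (down (i , j)) (here refl) = inj₂ (downFace-cong (sym (m+1-1 i)) refl)
∈faceEdges⇒upOf⊎downOf (down (i , j)) (there (here refl)) = inj₂ (downFace-cong refl (sym (m+1-1 j)))
∈faceEdges⇒upOf⊎downOf (down (i , j)) (there (there (here refl))) = inj₂ (downFace-cong refl (sym (m+1-1 j)))

∈faceEdges-upOf : ∀ e → e ∈ faceEdges (upOf e)
∈faceEdges-upOf (_ , d0) = here refl
∈faceEdges-upOf (_ , d1) = there (there (here refl))
∈faceEdges-upOf ((a , b) , d2) = there (here (edge-cong refl (sym (m-1+1 b))))

∈faceEdges-downOf : ∀ e → e ∈ faceEdges (downOf e)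
∈faceEdges-downOf ((a , b) , d0) = there (here (edge-cong refl (sym (m-1+1 b))))
∈faceEdges-downOf ((a , b) , d1) = here (edge-cong (sym (m-1+1 a)) refl)
∈faceEdges-downOf ((a , b) , d2) = there (there (here (edge-cong refl (sym (m-1+1 b)))))

∈-across : ∀ F {e} → e ∈ faceEdges F → e ∈ faceEdges (across F e)
∈-across F {e} m with ∈faceEdges⇒upOf⊎downOf F m
... | inj₁ refl rewrite across-upOf e = ∈faceEdges-downOf e
... | inj₂ refl rewrite across-downOf e = ∈faceEdges-upOf e

across-involutive : ∀ F {e} → e ∈ faceEdges F → across (across F e) e ≡ F
across-involutive F {e} m with ∈faceEdges⇒upOf⊎downOf F m
... | inj₁ refl rewrite across-upOf e = across-downOf e
... | inj₂ refl rewrite across-downOf e = across-upOf e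

isUp-across : ∀ F {e} → e ∈ faceEdges F → isUp (across F e) ≡ not (isUp F)
isUp-across F {e} m with ∈faceEdges⇒upOf⊎downOf F m
... | inj₁ refl rewrite across-upOf e | isUp-upOf e = isUp-downOf e
... | inj₂ refl rewrite across-downOf e | isUp-downOf e = isUp-upOf e

across-≢ : ∀ F {e} → e ∈ faceEdges F → across F e ≢ F
across-≢ F m eq = not-¬ refl (trans (sym (cong isUp eq)) (isUp-across F m))

shared-edge : ∀ F G {e} → e ∈ faceEdges F → e ∈ faceEdges G → G ≡ F ⊎ G ≡ across F e
shared-edge F G {e} mF mG with ∈faceEdges⇒upOf⊎downOf F mF | ∈faceEdges⇒upOf⊎downOf G mG
... | inj₁ refl | inj₁ refl = inj₁ refl
... | inj₂ refl | inj₂ refl = inj₁ refl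
... | inj₁ refl | inj₂ refl = inj₂ (sym (across-upOf e))
... | inj₂ refl | inj₁ refl = inj₂ (sym (across-downOf e))

data Pos : Set where
  P1 P2 P3 : Pos

_≟P_ : (p q : Pos) → Dec (p ≡ q)
P1 ≟P P1 = yes refl
P2 ≟P P2 = yes refl
P3 ≟P P3 = yes refl
P1 ≟P P2 = no λ ()
P1 ≟P P3 = no λ ()
P2 ≟P P1 = no λ ()
P2 ≟P P3 = no λ ()
P3 ≟P P1 = no λ ()
P3 ≟P P2 = no λ ()

sideAt : Face → Pos → Side
sideAt F P1 = proj₁ (sides F)
sideAt F P2 = proj₁ (proj₂ (sides F))
sideAt F P3 = proj₂ (proj₂ (sides F))

edgeAt : Face → Pos → Edge
edgeAt F p = proj₁ (sideAt F p)

ccwAt : Ori → Face → Pos → Bool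
ccwAt σ F p = ccw σ (sideAt F p)

edgeAt∈ : ∀ F p → edgeAt F p ∈ faceEdges F
edgeAt∈ (up _) P1 = here refl
edgeAt∈ (up _) P2 = there (here refl)
edgeAt∈ (up _) P3 = there (there (here refl))
edgeAt∈ (down _) P1 = here refl
edgeAt∈ (down _) P2 = there (here refl)
edgeAt∈ (down _) P3 = there (there (here refl))

∈faceEdges⇒edgeAt : ∀ F {e} → e ∈ faceEdges F → ∃ λ p → e ≡ edgeAt F p
∈faceEdges⇒edgeAt (up _) (here eq) = P1 , eq
∈faceEdges⇒edgeAt (up _) (there (here eq)) = P2 , eq
∈faceEdges⇒edgeAt (up _) (there (there (here eq))) = P3 , eq
∈faceEdges⇒edgeAt (down _) (here eq) = P1 , eq
∈faceEdges⇒edgeAt (down _) (there (here eq)) = P2 , eq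
∈faceEdges⇒edgeAt (down _) (there (there (here eq))) = P3 , eq

dirAt : Face → Pos → Dir
dirAt F p = proj₂ (edgeAt F p)

dirAt-injective : ∀ F p q → dirAt F p ≡ dirAt F q → p ≡ q
dirAt-injective (up _) P1 P1 _ = refl
dirAt-injective (up _) P2 P2 _ = refl
dirAt-injective (up _) P3 P3 _ = refl
dirAt-injective (down _) P1 P1 _ = refl
dirAt-injective (down _) P2 P2 _ = refl
dirAt-injective (down _) P3 P3 _ = refl
dirAt-injective (up _) P1 P2 ()
dirAt-injective (up _) P1 P3 ()
dirAt-injective (up _) P2 P1 ()
dirAt-injective (up _) P2 P3 ()
dirAt-injective (up _) P3 P1 ()
dirAt-injective (up _) P3 P2 ()
dirAt-injective (down _) P1 P2 ()
dirAt-injective (down _) P1 P3 ()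
dirAt-injective (down _) P2 P1 ()
dirAt-injective (down _) P2 P3 ()
dirAt-injective (down _) P3 P1 ()
dirAt-injective (down _) P3 P2 ()

edgeAt-injective : ∀ F p q → edgeAt F p ≡ edgeAt F q → p ≡ q
edgeAt-injective F p q eq = dirAt-injective F p q (cong proj₂ eq)

sameDir⇒≡ : ∀ F {s t} → s ∈ faceEdges F → t ∈ faceEdges F → proj₂ s ≡ proj₂ t → s ≡ t
sameDir⇒≡ F ms mt eq with ∈faceEdges⇒edgeAt F ms | ∈faceEdges⇒edgeAt F mt
... | p , refl | q , refl with dirAt-injective F p q eq
...   | refl = refl

allPos : List Pos
allPos = P1 ∷ P2 ∷ P3 ∷ []

∈allPos : ∀ p → p ∈ allPos
∈allPos P1 = here refl
∈allPos P2 = there (here refl)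
∈allPos P3 = there (there (here refl))

no-four-positions : ∀ {p q r s} → Unique (p ∷ q ∷ r ∷ s ∷ []) → ⊥
no-four-positions u with Unique-⊆⇒length≤ u (λ {x} _ → ∈allPos x)
... | s≤s (s≤s (s≤s ()))

three-positions : ∀ {p q r} s → p ≢ q → p ≢ r → q ≢ r → s ≡ p ⊎ s ≡ q ⊎ s ≡ r
three-positions {p} {q} {r} s p≢q p≢r q≢r with s ≟P p | s ≟P q | s ≟P r
... | yes s≡p | _ | _ = inj₁ s≡p
... | no _ | yes s≡q | _ = inj₂ (inj₁ s≡q)
... | no _ | no _ | yes s≡r = inj₂ (inj₂ s≡r)
... | no s≢p | no s≢q | no s≢r = ⊥-elim (no-four-positions
        ((p≢q ∷ p≢r ∷ (λ eq → s≢p (sym eq)) ∷ []) ∷ (q≢r ∷ (λ eq → s≢q (sym eq)) ∷ [])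
         ∷ ((λ eq → s≢r (sym eq)) ∷ []) ∷ [] ∷ []))

the-other-side : ∀ F {e b x y} → e ∈ faceEdges F → b ∈ faceEdges F → x ∈ faceEdges F → y ∈ faceEdges F →
                 e ≢ b → x ≢ e → x ≢ b → y ≡ e ⊎ y ≡ b ⊎ y ≡ x
the-other-side F me mb mx my e≢b x≢e x≢b
  with ∈faceEdges⇒edgeAt F me | ∈faceEdges⇒edgeAt F mb | ∈faceEdges⇒edgeAt F mx | ∈faceEdges⇒edgeAt F my
... | pe , refl | pb , refl | px , refl | py , refl
  with three-positions {pe} {pb} {px} py (λ eq → e≢b (cong (edgeAt F) eq)) (λ eq → x≢e (cong (edgeAt F) (sym eq)))
                          (λ eq → x≢b (cong (edgeAt F) (sym eq)))
...   | inj₁ refl = inj₁ refl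
...   | inj₂ (inj₁ refl) = inj₂ (inj₁ refl)
...   | inj₂ (inj₂ refl) = inj₂ (inj₂ refl)

allEqual : Bool → Bool → Bool → Bool
allEqual c₁ c₂ c₃ = beq c₁ c₂ ∧ beq c₂ c₃

oddOne : Bool → Bool → Bool → Pos
oddOne c₁ c₂ c₃ = if beq c₁ c₂ then P3 else (if beq c₁ c₃ then P2 else P1)
  where open import Data.Bool using (if_then_else_)

pick : Bool → Bool → Bool → Pos → Bool
pick c₁ c₂ c₃ P1 = c₁
pick c₁ c₂ c₃ P2 = c₂
pick c₁ c₂ c₃ P3 = c₃

oddOne-odd : ∀ c₁ c₂ c₃ → allEqual c₁ c₂ c₃ ≡ false → ∀ p → p ≢ oddOne c₁ c₂ c₃ →
             pick c₁ c₂ c₃ p ≡ not (pick c₁ c₂ c₃ (oddOne c₁ c₂ c₃))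
oddOne-odd true true true () _ _
oddOne-odd false false false () _ _
oddOne-odd true true false _ P1 _ = refl
oddOne-odd true true false _ P2 _ = refl
oddOne-odd true true false _ P3 ne = ⊥-elim (ne refl)
oddOne-odd false false true _ P1 _ = refl
oddOne-odd false false true _ P2 _ = refl
oddOne-odd false false true _ P3 ne = ⊥-elim (ne refl)
oddOne-odd true false true _ P1 _ = refl
oddOne-odd true false true _ P3 _ = refl
oddOne-odd true false true _ P2 ne = ⊥-elim (ne refl)
oddOne-odd false true false _ P1 _ = refl
oddOne-odd false true false _ P3 _ = refl
oddOne-odd false true false _ P2 ne = ⊥-elim (ne refl)
oddOne-odd true false false _ P2 _ = refl
oddOne-odd true false false _ P3 _ = refl
oddOne-odd true false false _ P1 ne = ⊥-elim (ne refl)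
oddOne-odd false true true _ P2 _ = refl
oddOne-odd false true true _ P3 _ = refl
oddOne-odd false true true _ P1 ne = ⊥-elim (ne refl)

allEqual-pick : ∀ c₁ c₂ c₃ → allEqual c₁ c₂ c₃ ≡ true → ∀ p → pick c₁ c₂ c₃ p ≡ c₁
allEqual-pick true true true _ P1 = refl
allEqual-pick true true true _ P2 = refl
allEqual-pick true true true _ P3 = refl
allEqual-pick false false false _ P1 = refl
allEqual-pick false false false _ P2 = refl
allEqual-pick false false false _ P3 = refl
allEqual-pick true true false () _
allEqual-pick true false true () _
allEqual-pick true false false () _
allEqual-pick false true true () _
allEqual-pick false true false () _
allEqual-pick false false true () _

allEqual-same : ∀ c → allEqual c c c ≡ true
allEqual-same true = refl
allEqual-same false = refl

module _ (σ : Ori) (F : Face) where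

  ccws : Pos → Bool
  ccws = pick (ccwAt σ F P1) (ccwAt σ F P2) (ccwAt σ F P3)

  ccwAt≡ccws : ∀ p → ccwAt σ F p ≡ ccws p
  ccwAt≡ccws P1 = refl
  ccwAt≡ccws P2 = refl
  ccwAt≡ccws P3 = refl

  blockingPos : Pos
  blockingPos = oddOne (ccwAt σ F P1) (ccwAt σ F P2) (ccwAt σ F P3)

isDirected≡allEqual : ∀ σ F → isDirected σ F ≡ allEqual (ccwAt σ F P1) (ccwAt σ F P2) (ccwAt σ F P3)
isDirected≡allEqual σ (up _) = refl
isDirected≡allEqual σ (down _) = refl

blocking≡edgeAt : ∀ σ F → blocking σ F ≡ edgeAt F (blockingPos σ F)
blocking≡edgeAt σ F = trans (unfold F) (select F (ccwAt σ F P1) (ccwAt σ F P2) (ccwAt σ F P3))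
  where
  open import Data.Bool using (if_then_else_)
  unfold : ∀ F → blocking σ F ≡ (if beq (ccwAt σ F P1) (ccwAt σ F P2) then edgeAt F P3
                                 else (if beq (ccwAt σ F P1) (ccwAt σ F P3) then edgeAt F P2 else edgeAt F P1))
  unfold (up _) = refl
  unfold (down _) = refl
  select : ∀ F c₁ c₂ c₃ → (if beq c₁ c₂ then edgeAt F P3 else (if beq c₁ c₃ then edgeAt F P2 else edgeAt F P1))
                          ≡ edgeAt F (oddOne c₁ c₂ c₃)
  select F true true _ = refl
  select F false false _ = refl
  select F true false true = refl
  select F true false false = refl
  select F false true true = refl
  select F false true false = refl

blocking∈ : ∀ σ F → blocking σ F ∈ faceEdges F
blocking∈ σ F = subst (_∈ faceEdges F) (sym (blocking≡edgeAt σ F)) (edgeAt∈ F (blockingPos σ F))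

blocking≡edgeAt⇒ : ∀ σ F {p} → blocking σ F ≡ edgeAt F p → blockingPos σ F ≡ p
blocking≡edgeAt⇒ σ F eq = edgeAt-injective F _ _ (trans (sym (blocking≡edgeAt σ F)) eq)

blocking-odd : ∀ σ F → isDirected σ F ≡ false → ∀ p → p ≢ blockingPos σ F →
               ccwAt σ F p ≡ not (ccwAt σ F (blockingPos σ F))
blocking-odd σ F nd p ne =
  trans (ccwAt≡ccws σ F p)
    (trans (oddOne-odd _ _ _ (trans (sym (isDirected≡allEqual σ F)) nd) p ne)
           (cong not (sym (ccwAt≡ccws σ F _))))

directed-ccw : ∀ σ F → isDirected σ F ≡ true → ∀ p q → ccwAt σ F p ≡ ccwAt σ F q
directed-ccw σ F d p q = trans (trans (ccwAt≡ccws σ F p) (pick≡ p)) (sym (trans (ccwAt≡ccws σ F q) (pick≡ q)))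
  where
  pick≡ = allEqual-pick _ _ _ (trans (sym (isDirected≡allEqual σ F)) d)

constant-ccw⇒directed : ∀ σ F c → (∀ p → ccwAt σ F p ≡ c) → isDirected σ F ≡ true
constant-ccw⇒directed σ F c h rewrite isDirected≡allEqual σ F | h P1 | h P2 | h P3 = allEqual-same c

module OneSideFlipped {ρ ρ′ : Ori} {F : Face} {q : Pos}
         (same : ∀ p → p ≢ q → ccwAt ρ′ F p ≡ ccwAt ρ F p)
         (flipped : ccwAt ρ′ F q ≡ not (ccwAt ρ F q))
         (nd : isDirected ρ F ≡ false) (nd′ : isDirected ρ′ F ≡ false) where

  blockingPos≢flipped : blockingPos ρ F ≢ q
  blockingPos≢flipped b≡q = not-¬ refl (trans (sym (constant-ccw⇒directed ρ′ F _ ccw′)) nd′)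
    where
    ccw′ : ∀ p → ccwAt ρ′ F p ≡ not (ccwAt ρ F (blockingPos ρ F))
    ccw′ p with p ≟P q
    ... | yes refl = trans flipped (cong (λ r → not (ccwAt ρ F r)) (sym b≡q))
    ... | no p≢q = trans (same p p≢q) (blocking-odd ρ F nd p (λ p≡b → p≢q (trans p≡b b≡q)))

  blockingPos-moves : blockingPos ρ F ≢ blockingPos ρ′ F
  blockingPos-moves b≡b′ = not-¬ refl contradiction
    where
    b = blockingPos ρ F
    q≢b : q ≢ b
    q≢b q≡b = blockingPos≢flipped (sym q≡b)
    contradiction : ccwAt ρ′ F b ≡ not (ccwAt ρ′ F b)
    contradiction = begin
      ccwAt ρ′ F b                 ≡⟨ same b (λ b≡q → q≢b (sym b≡q)) ⟩
      ccwAt ρ F b                  ≡⟨ sym (not-involutive _) ⟩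
      not (not (ccwAt ρ F b))      ≡⟨ cong not (sym (blocking-odd ρ F nd q q≢b)) ⟩
      not (ccwAt ρ F q)            ≡⟨ sym flipped ⟩
      ccwAt ρ′ F q                 ≡⟨ blocking-odd ρ′ F nd′ q (λ q≡b′ → q≢b (trans q≡b′ (sym b≡b′))) ⟩
      not (ccwAt ρ′ F (blockingPos ρ′ F)) ≡⟨ cong (λ r → not (ccwAt ρ′ F r)) (sym b≡b′) ⟩
      not (ccwAt ρ′ F b)           ∎
      where open ≡-Reasoning

blocked-at : ∀ σ F → isDirected σ F ≡ false → ∀ b → blocking σ F ≡ edgeAt F b →
             ∀ p → p ≢ b → ccwAt σ F p ≡ not (ccwAt σ F b)
blocked-at σ F nd b eq p p≢b =
  subst (λ r → ccwAt σ F p ≡ not (ccwAt σ F r)) b′≡b (blocking-odd σ F nd p (λ p≡b′ → p≢b (trans p≡b′ b′≡b)))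
  where
  b′≡b = blocking≡edgeAt⇒ σ F {b} eq

-- Levels of triangles along a direction

-- Position of a triangle along its strip of direction γ: crossing a side of direction γ leaves it
-- unchanged, crossing any other side changes it by ±1 (level-across).
level : Dir → Face → ℤ
level d0 (up (i , j)) = i ℤ.+ i ℤ.+ j ℤ.+ + 1
level d0 (down (i , j)) = i ℤ.+ i ℤ.+ j ℤ.+ + 2
level d1 (up (i , j)) = i ℤ.+ j ℤ.+ j ℤ.+ + 1
level d1 (down (i , j)) = i ℤ.+ j ℤ.+ j ℤ.+ + 2
level d2 (up (i , j)) = i ℤ.- j
level d2 (down (i , j)) = i ℤ.- j

crossing : Dir → Dir → ℤ
crossing d0 d0 = + 0
crossing d0 d1 = -[1+ 0 ]
crossing d0 d2 = + 1
crossing d1 d0 = -[1+ 0 ]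
crossing d1 d1 = + 0
crossing d1 d2 = + 1
crossing d2 d0 = + 1
crossing d2 d1 = -[1+ 0 ]
crossing d2 d2 = + 0

signed : Bool → ℤ → ℤ
signed true x = x
signed false x = ℤ.- x

level-downOf : ∀ γ e → level γ (downOf e) ≡ level γ (upOf e) ℤ.+ crossing γ (proj₂ e)
level-downOf d0 ((a , b) , d0) = l a b
  where l : ∀ a b → a ℤ.+ a ℤ.+ (b ℤ.- + 1) ℤ.+ + 2 ≡ a ℤ.+ a ℤ.+ b ℤ.+ + 1 ℤ.+ + 0
        l = solve-∀
level-downOf d0 ((a , b) , d1) = l a b
  where l : ∀ a b → (a ℤ.- + 1) ℤ.+ (a ℤ.- + 1) ℤ.+ b ℤ.+ + 2 ≡ a ℤ.+ a ℤ.+ b ℤ.+ + 1 ℤ.+ -[1+ 0 ]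
        l = solve-∀
level-downOf d0 ((a , b) , d2) = l a b
  where l : ∀ a b → a ℤ.+ a ℤ.+ (b ℤ.- + 1) ℤ.+ + 2 ≡ a ℤ.+ a ℤ.+ (b ℤ.- + 1) ℤ.+ + 1 ℤ.+ + 1
        l = solve-∀
level-downOf d1 ((a , b) , d0) = l a b
  where l : ∀ a b → a ℤ.+ (b ℤ.- + 1) ℤ.+ (b ℤ.- + 1) ℤ.+ + 2 ≡ a ℤ.+ b ℤ.+ b ℤ.+ + 1 ℤ.+ -[1+ 0 ]
        l = solve-∀
level-downOf d1 ((a , b) , d1) = l a b
  where l : ∀ a b → (a ℤ.- + 1) ℤ.+ b ℤ.+ b ℤ.+ + 2 ≡ a ℤ.+ b ℤ.+ b ℤ.+ + 1 ℤ.+ + 0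
        l = solve-∀
level-downOf d1 ((a , b) , d2) = l a b
  where l : ∀ a b → a ℤ.+ (b ℤ.- + 1) ℤ.+ (b ℤ.- + 1) ℤ.+ + 2 ≡ a ℤ.+ (b ℤ.- + 1) ℤ.+ (b ℤ.- + 1) ℤ.+ + 1 ℤ.+ + 1
        l = solve-∀
level-downOf d2 ((a , b) , d0) = l a b
  where l : ∀ a b → a ℤ.- (b ℤ.- + 1) ≡ a ℤ.- b ℤ.+ + 1
        l = solve-∀
level-downOf d2 ((a , b) , d1) = l a b
  where l : ∀ a b → (a ℤ.- + 1) ℤ.- b ≡ a ℤ.- b ℤ.+ -[1+ 0 ]
        l = solve-∀
level-downOf d2 ((a , b) , d2) = l a b
  where l : ∀ a b → a ℤ.- (b ℤ.- + 1) ≡ a ℤ.- (b ℤ.- + 1) ℤ.+ + 0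
        l = solve-∀

level-across : ∀ γ F {e} → e ∈ faceEdges F →
               level γ (across F e) ≡ level γ F ℤ.+ signed (isUp F) (crossing γ (proj₂ e))
level-across γ F {e} m with ∈faceEdges⇒upOf⊎downOf F m
... | inj₁ refl rewrite across-upOf e | isUp-upOf e = level-downOf γ e
... | inj₂ refl rewrite across-downOf e | isUp-downOf e =
  trans (sym (cancel (level γ (upOf e)) (crossing γ (proj₂ e))))
        (cong (ℤ._+ ℤ.- crossing γ (proj₂ e)) (sym (level-downOf γ e)))
  where
  cancel : ∀ x y → (x ℤ.+ y) ℤ.+ ℤ.- y ≡ x
  cancel = solve-∀

crossing-self : ∀ γ → crossing γ γ ≡ + 0
crossing-self d0 = refl
crossing-self d1 = refl
crossing-self d2 = refl

UnitStep : ℤ → Set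
UnitStep c = c ≡ + 1 ⊎ c ≡ -[1+ 0 ]

crossing-unit : ∀ γ α → α ≢ γ → UnitStep (crossing γ α)
crossing-unit d0 d0 ne = ⊥-elim (ne refl)
crossing-unit d1 d1 ne = ⊥-elim (ne refl)
crossing-unit d2 d2 ne = ⊥-elim (ne refl)
crossing-unit d0 d1 ne = inj₂ refl
crossing-unit d0 d2 ne = inj₁ refl
crossing-unit d1 d0 ne = inj₂ refl
crossing-unit d1 d2 ne = inj₁ refl
crossing-unit d2 d0 ne = inj₁ refl
crossing-unit d2 d1 ne = inj₂ refl

signed-unit : ∀ u {c} → UnitStep c → UnitStep (signed u c)
signed-unit true h = h
signed-unit false (inj₁ refl) = inj₂ refl
signed-unit false (inj₂ refl) = inj₁ refl

signed-zero : ∀ u → signed u (+ 0) ≡ + 0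
signed-zero true = refl
signed-zero false = refl

UnitStep≢0 : ∀ {c} → UnitStep c → c ≢ + 0
UnitStep≢0 (inj₁ refl) ()
UnitStep≢0 (inj₂ refl) ()

+-cancelˡ : ∀ x {a b} → x ℤ.+ a ≡ x ℤ.+ b → a ≡ b
+-cancelˡ x {a} {b} h = trans (sym (lem x a)) (trans (cong (ℤ._- x) h) (lem x b))
  where
  lem : ∀ x a → x ℤ.+ a ℤ.- x ≡ a
  lem = solve-∀

-- Crossing s leaves the level along direction (dir s) unchanged; crossing a side of another direction changes it.
across-injective : ∀ F {s t} → s ∈ faceEdges F → t ∈ faceEdges F → across F s ≡ across F t → s ≡ t
across-injective F {s} {t} ms mt eq with proj₂ t ≟D proj₂ s
... | yes same = sym (sameDir⇒≡ F mt ms same)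
... | no differ = ⊥-elim (UnitStep≢0 (signed-unit (isUp F) (crossing-unit γ (proj₂ t) differ)) no-step)
  where
  γ = proj₂ s
  levels : signed (isUp F) (crossing γ γ) ≡ signed (isUp F) (crossing γ (proj₂ t))
  levels = +-cancelˡ (level γ F)
             (trans (sym (level-across γ F ms)) (trans (cong (level γ) eq) (level-across γ F mt)))
  no-step : signed (isUp F) (crossing γ (proj₂ t)) ≡ + 0
  no-step = trans (sym levels) (trans (cong (signed (isUp F)) (crossing-self γ)) (signed-zero (isUp F)))

-- The six triangles around a vertex

-- A spoke at a vertex is given by its direction and by whether it points away from the vertex;
-- k0, …, k5 list the spokes counterclockwise.
Spoke : Set
Spoke = Dir × Bool

pattern k0 = d0 , true
pattern k1 = d1 , true
pattern k2 = d2 , false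
pattern k3 = d0 , false
pattern k4 = d1 , false
pattern k5 = d2 , true

spokeDir : Spoke → Dir
spokeDir = proj₁

outFlag : Spoke → Bool
outFlag = proj₂

next : Spoke → Spoke
next k0 = k1
next k1 = k2
next k2 = k3
next k3 = k4
next k4 = k5
next k5 = k0

prev : Spoke → Spoke
prev k0 = k5
prev k1 = k0
prev k2 = k1
prev k3 = k2
prev k4 = k3
prev k5 = k4

next-prev : ∀ k → next (prev k) ≡ k
next-prev k0 = refl
next-prev k1 = refl
next-prev k2 = refl
next-prev k3 = refl
next-prev k4 = refl
next-prev k5 = refl

_+1 : ℤ → ℤ
x +1 = x ℤ.+ + 1

-- The star is indexed by w and centred at hub w = w ⊕ (1,1), so that no subtraction occurs.
hub : V → V
hub (a , b) = (a +1 , b +1)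

spoke : V → Spoke → Edge
spoke (a , b) k0 = ((a +1 , b +1) , d0)
spoke (a , b) k1 = ((a +1 , b +1) , d1)
spoke (a , b) k2 = ((a , (b +1) +1) , d2)
spoke (a , b) k3 = ((a , b +1) , d0)
spoke (a , b) k4 = ((a +1 , b) , d1)
spoke (a , b) k5 = ((a +1 , b +1) , d2)

-- the triangle between spoke k and spoke (next k), and its side opposite the hub
sector : V → Spoke → Face
sector (a , b) k0 = up (a +1 , b +1)
sector (a , b) k1 = down (a , b +1)
sector (a , b) k2 = up (a , b +1)
sector (a , b) k3 = down (a , b)
sector (a , b) k4 = up (a +1 , b)
sector (a , b) k5 = down (a +1 , b)

rim : V → Spoke → Edge
rim (a , b) k0 = ((a +1 , (b +1) +1) , d2)
rim (a , b) k1 = ((a , (b +1) +1) , d0)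
rim (a , b) k2 = ((a , b +1) , d1)
rim (a , b) k3 = ((a , b +1) , d2)
rim (a , b) k4 = ((a +1 , b) , d0)
rim (a , b) k5 = (((a +1) +1 , b) , d1)

outward : Ori → V → Spoke → Bool
outward σ w k = ccw σ (spoke w k , outFlag k)

posSpoke posNext posRim : Spoke → Pos
posSpoke k0 = P1
posSpoke k1 = P1
posSpoke k2 = P2
posSpoke k3 = P2
posSpoke k4 = P3
posSpoke k5 = P3
posNext k0 = P3
posNext k1 = P3
posNext k2 = P1
posNext k3 = P1
posNext k4 = P2
posNext k5 = P2
posRim k0 = P2
posRim k1 = P2
posRim k2 = P3
posRim k3 = P3
posRim k4 = P1
posRim k5 = P1

edgeAt-posSpoke : ∀ w k → edgeAt (sector w k) (posSpoke k) ≡ spoke w k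
edgeAt-posSpoke (a , b) k0 = refl
edgeAt-posSpoke (a , b) k1 = refl
edgeAt-posSpoke (a , b) k2 = refl
edgeAt-posSpoke (a , b) k3 = refl
edgeAt-posSpoke (a , b) k4 = refl
edgeAt-posSpoke (a , b) k5 = refl

edgeAt-posNext : ∀ w k → edgeAt (sector w k) (posNext k) ≡ spoke w (next k)
edgeAt-posNext (a , b) k0 = refl
edgeAt-posNext (a , b) k1 = refl
edgeAt-posNext (a , b) k2 = refl
edgeAt-posNext (a , b) k3 = refl
edgeAt-posNext (a , b) k4 = refl
edgeAt-posNext (a , b) k5 = refl

edgeAt-posRim : ∀ w k → edgeAt (sector w k) (posRim k) ≡ rim w k
edgeAt-posRim (a , b) k0 = refl
edgeAt-posRim (a , b) k1 = refl
edgeAt-posRim (a , b) k2 = refl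
edgeAt-posRim (a , b) k3 = refl
edgeAt-posRim (a , b) k4 = refl
edgeAt-posRim (a , b) k5 = refl

ccwAt-posSpoke : ∀ σ w k → ccwAt σ (sector w k) (posSpoke k) ≡ outward σ w k
ccwAt-posSpoke σ (a , b) k0 = refl
ccwAt-posSpoke σ (a , b) k1 = refl
ccwAt-posSpoke σ (a , b) k2 = refl
ccwAt-posSpoke σ (a , b) k3 = refl
ccwAt-posSpoke σ (a , b) k4 = refl
ccwAt-posSpoke σ (a , b) k5 = refl

ccw-not : ∀ σ e t → ccw σ (e , not t) ≡ not (ccw σ (e , t))
ccw-not σ e t with σ e | t
... | true | true = refl
... | true | false = refl
... | false | true = refl
... | false | false = refl

ccwAt-posNext : ∀ σ w k → ccwAt σ (sector w k) (posNext k) ≡ not (outward σ w (next k))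
ccwAt-posNext σ (a , b) k0 = ccw-not σ _ true
ccwAt-posNext σ (a , b) k1 = ccw-not σ _ false
ccwAt-posNext σ (a , b) k2 = ccw-not σ _ false
ccwAt-posNext σ (a , b) k3 = ccw-not σ _ false
ccwAt-posNext σ (a , b) k4 = ccw-not σ _ true
ccwAt-posNext σ (a , b) k5 = ccw-not σ _ true

posSpoke≢posNext : ∀ k → posSpoke k ≢ posNext k
posSpoke≢posNext k0 ()
posSpoke≢posNext k1 ()
posSpoke≢posNext k2 ()
posSpoke≢posNext k3 ()
posSpoke≢posNext k4 ()
posSpoke≢posNext k5 ()

posSpoke≢posRim : ∀ k → posSpoke k ≢ posRim k
posSpoke≢posRim k0 ()
posSpoke≢posRim k1 ()
posSpoke≢posRim k2 ()
posSpoke≢posRim k3 ()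
posSpoke≢posRim k4 ()
posSpoke≢posRim k5 ()

posNext≢posRim : ∀ k → posNext k ≢ posRim k
posNext≢posRim k0 ()
posNext≢posRim k1 ()
posNext≢posRim k2 ()
posNext≢posRim k3 ()
posNext≢posRim k4 ()
posNext≢posRim k5 ()

∈sector : ∀ w k {e} → e ∈ faceEdges (sector w k) → e ≡ spoke w k ⊎ e ≡ spoke w (next k) ⊎ e ≡ rim w k
∈sector w k m with ∈faceEdges⇒edgeAt (sector w k) m
... | p , refl with three-positions p (posSpoke≢posNext k) (posSpoke≢posRim k) (posNext≢posRim k)
...   | inj₁ refl = inj₁ (edgeAt-posSpoke w k)
...   | inj₂ (inj₁ refl) = inj₂ (inj₁ (edgeAt-posNext w k))
...   | inj₂ (inj₂ refl) = inj₂ (inj₂ (edgeAt-posRim w k))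

spoke∈sector : ∀ w k → spoke w k ∈ faceEdges (sector w k)
spoke∈sector w k = subst (_∈ faceEdges (sector w k)) (edgeAt-posSpoke w k) (edgeAt∈ (sector w k) (posSpoke k))

next-spoke∈sector : ∀ w k → spoke w (next k) ∈ faceEdges (sector w k)
next-spoke∈sector w k = subst (_∈ faceEdges (sector w k)) (edgeAt-posNext w k) (edgeAt∈ (sector w k) (posNext k))

blocked-at-spoke⇒outward≡ : ∀ σ w k → isDirected σ (sector w k) ≡ false →
                            blocking σ (sector w k) ≡ spoke w k ⊎ blocking σ (sector w k) ≡ spoke w (next k) →
                            outward σ w k ≡ outward σ w (next k)
blocked-at-spoke⇒outward≡ σ w k nd (inj₁ eq) =
  sym (not-injective (trans (sym (ccwAt-posNext σ w k))
        (trans (blocked-at σ (sector w k) nd (posSpoke k) (trans eq (sym (edgeAt-posSpoke w k))) (posNext k)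
                 (λ e → posSpoke≢posNext k (sym e)))
               (cong not (ccwAt-posSpoke σ w k)))))
blocked-at-spoke⇒outward≡ σ w k nd (inj₂ eq) =
  trans (sym (ccwAt-posSpoke σ w k))
    (trans (blocked-at σ (sector w k) nd (posNext k) (trans eq (sym (edgeAt-posNext w k))) (posSpoke k)
             (posSpoke≢posNext k))
           (trans (cong not (ccwAt-posNext σ w k)) (not-involutive _)))

blocked-at-rim⇒outward≢ : ∀ σ w k → isDirected σ (sector w k) ≡ false → blocking σ (sector w k) ≡ rim w k →
                          outward σ w k ≡ not (outward σ w (next k))
blocked-at-rim⇒outward≢ σ w k nd eq =
  trans (sym (ccwAt-posSpoke σ w k))
    (trans (blocked-at σ (sector w k) nd (posRim k) rim≡ (posSpoke k) (posSpoke≢posRim k))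
      (trans (sym (blocked-at σ (sector w k) nd (posRim k) rim≡ (posNext k) (posNext≢posRim k)))
             (ccwAt-posNext σ w k)))
  where
  rim≡ = trans eq (sym (edgeAt-posRim w k))

directed⇒outward≢ : ∀ σ w k → isDirected σ (sector w k) ≡ true → outward σ w k ≡ not (outward σ w (next k))
directed⇒outward≢ σ w k d =
  trans (sym (ccwAt-posSpoke σ w k))
    (trans (directed-ccw σ (sector w k) d (posSpoke k) (posNext k)) (ccwAt-posNext σ w k))

isUp-next-sector : ∀ w k → isUp (sector w (next k)) ≡ not (isUp (sector w k))
isUp-next-sector (a , b) k0 = refl
isUp-next-sector (a , b) k1 = refl
isUp-next-sector (a , b) k2 = refl
isUp-next-sector (a , b) k3 = refl
isUp-next-sector (a , b) k4 = refl
isUp-next-sector (a , b) k5 = refl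

across-next-spoke : ∀ w k → across (sector w k) (spoke w (next k)) ≡ sector w (next k)
across-next-spoke w k with shared-edge (sector w k) (sector w (next k)) (next-spoke∈sector w k) (spoke∈sector w (next k))
... | inj₂ eq = sym eq
... | inj₁ eq = ⊥-elim (not-¬ refl (trans (cong isUp (sym eq)) (isUp-next-sector w k)))

across-spoke : ∀ w k → across (sector w (next k)) (spoke w (next k)) ≡ sector w k
across-spoke w k = trans (cong (λ F → across F (spoke w (next k))) (sym (across-next-spoke w k)))
                         (across-involutive (sector w k) (next-spoke∈sector w k))

spokeDir-spoke : ∀ w k → proj₂ (spoke w k) ≡ spokeDir k
spokeDir-spoke (a , b) k0 = refl
spokeDir-spoke (a , b) k1 = refl
spokeDir-spoke (a , b) k2 = refl
spokeDir-spoke (a , b) k3 = refl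
spokeDir-spoke (a , b) k4 = refl
spokeDir-spoke (a , b) k5 = refl

rimDir : ∀ w k → proj₂ (rim w k) ≡ spokeDir (next (next k))
rimDir (a , b) k0 = refl
rimDir (a , b) k1 = refl
rimDir (a , b) k2 = refl
rimDir (a , b) k3 = refl
rimDir (a , b) k4 = refl
rimDir (a , b) k5 = refl

spokeDir-next³ : ∀ k → spokeDir (next (next (next k))) ≡ spokeDir k
spokeDir-next³ k0 = refl
spokeDir-next³ k1 = refl
spokeDir-next³ k2 = refl
spokeDir-next³ k3 = refl
spokeDir-next³ k4 = refl
spokeDir-next³ k5 = refl

spokeDir-next : ∀ k → spokeDir k ≢ spokeDir (next k)
spokeDir-next k0 ()
spokeDir-next k1 ()
spokeDir-next k2 ()
spokeDir-next k3 ()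
spokeDir-next k4 ()
spokeDir-next k5 ()

spokeDir-next² : ∀ k → spokeDir k ≢ spokeDir (next (next k))
spokeDir-next² k0 ()
spokeDir-next² k1 ()
spokeDir-next² k2 ()
spokeDir-next² k3 ()
spokeDir-next² k4 ()
spokeDir-next² k5 ()

Corner : Face → Pos → Pos → Set
Corner F p q = ∃ λ w → ∃ λ k → F ≡ sector w k ×
  ((edgeAt F p ≡ spoke w k × edgeAt F q ≡ spoke w (next k)) ⊎ (edgeAt F p ≡ spoke w (next k) × edgeAt F q ≡ spoke w k))

corner-swap : ∀ {F p q} → Corner F p q → Corner F q p
corner-swap (w , k , eq , inj₁ (a , b)) = w , k , eq , inj₂ (b , a)
corner-swap (w , k , eq , inj₂ (a , b)) = w , k , eq , inj₁ (b , a)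

corner : ∀ F p q → p ≢ q → Corner F p q
corner F P1 P1 ne = ⊥-elim (ne refl)
corner F P2 P2 ne = ⊥-elim (ne refl)
corner F P3 P3 ne = ⊥-elim (ne refl)
corner (up (i , j)) P1 P3 _ = (i ℤ.- + 1 , j ℤ.- + 1) , k0 , upFace-cong (sym (m-1+1 i)) (sym (m-1+1 j)) ,
  inj₁ (edge-cong (sym (m-1+1 i)) (sym (m-1+1 j)) , edge-cong (sym (m-1+1 i)) (sym (m-1+1 j)))
corner (up (i , j)) P2 P1 _ = (i , j ℤ.- + 1) , k2 , upFace-cong refl (sym (m-1+1 j)) ,
  inj₁ (edge-cong refl (cong _+1 (sym (m-1+1 j))) , edge-cong refl (sym (m-1+1 j)))
corner (up (i , j)) P3 P2 _ = (i ℤ.- + 1 , j) , k4 , upFace-cong (sym (m-1+1 i)) refl ,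
  inj₁ (edge-cong (sym (m-1+1 i)) refl , edge-cong (sym (m-1+1 i)) refl)
corner (down (i , j)) P1 P3 _ = (i , j ℤ.- + 1) , k1 , downFace-cong refl (sym (m-1+1 j)) ,
  inj₁ (edge-cong refl (sym (m-1+1 j)) , edge-cong refl (cong _+1 (sym (m-1+1 j))))
corner (down (i , j)) P2 P1 _ = (i , j) , k3 , refl , inj₁ (refl , refl)
corner (down (i , j)) P3 P2 _ = (i ℤ.- + 1 , j) , k5 , downFace-cong (sym (m-1+1 i)) refl ,
  inj₁ (edge-cong (sym (m-1+1 i)) refl , edge-cong (sym (m-1+1 i)) refl)
corner F@(up _) P3 P1 _ = corner-swap {F} {P1} {P3} (corner F P1 P3 λ ())
corner F@(up _) P1 P2 _ = corner-swap {F} {P2} {P1} (corner F P2 P1 λ ())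
corner F@(up _) P2 P3 _ = corner-swap {F} {P3} {P2} (corner F P3 P2 λ ())
corner F@(down _) P3 P1 _ = corner-swap {F} {P1} {P3} (corner F P1 P3 λ ())
corner F@(down _) P1 P2 _ = corner-swap {F} {P2} {P1} (corner F P2 P1 λ ())
corner F@(down _) P2 P3 _ = corner-swap {F} {P3} {P2} (corner F P3 P2 λ ())

-- Eulerian orientations at a vertex

allSpokes : List Spoke
allSpokes = k0 ∷ k1 ∷ k2 ∷ k3 ∷ k4 ∷ k5 ∷ []

∈allSpokes : ∀ k → k ∈ allSpokes
∈allSpokes k0 = here refl
∈allSpokes k1 = there (here refl)
∈allSpokes k2 = there (there (here refl))
∈allSpokes k3 = there (there (there (here refl)))
∈allSpokes k4 = there (there (there (there (here refl))))
∈allSpokes k5 = there (there (there (there (there (here refl)))))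

,-injective : ∀ {a b c d : ℤ} → (a , b) ≡ (c , d) → a ≡ c × b ≡ d
,-injective refl = refl , refl

+1-injective : ∀ {x y} → x +1 ≡ y +1 → x ≡ y
+1-injective {x} {y} eq = trans (sym (m+1-1 x)) (trans (cong (ℤ._- + 1) eq) (m+1-1 y))

spoke∈ : ∀ w k → spoke w k ∈ map (spoke w) allSpokes
spoke∈ w k = ∈-map⁺ (spoke w) (∈allSpokes k)

incident⇒spoke : ∀ w e → tailE e ≡ hub w ⊎ headE e ≡ hub w → e ∈ map (spoke w) allSpokes
incident⇒spoke w (_ , d0) (inj₁ refl) = spoke∈ w k0
incident⇒spoke w (_ , d1) (inj₁ refl) = spoke∈ w k1
incident⇒spoke w (_ , d2) (inj₁ refl) = spoke∈ w k5
incident⇒spoke (a , b) ((p , q) , d0) (inj₂ eq) with ,-injective eq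
... | e₁ , e₂ = subst (_∈ map (spoke (a , b)) allSpokes)
                (edge-cong (sym (+1-injective e₁)) (sym (trans (sym (ℤP.+-identityʳ q)) e₂))) (spoke∈ (a , b) k3)
incident⇒spoke (a , b) ((p , q) , d1) (inj₂ eq) with ,-injective eq
... | e₁ , e₂ = subst (_∈ map (spoke (a , b)) allSpokes)
                (edge-cong (sym (trans (sym (ℤP.+-identityʳ p)) e₁)) (sym (+1-injective e₂))) (spoke∈ (a , b) k4)
incident⇒spoke (a , b) ((p , q) , d2) (inj₂ eq) with ,-injective eq
... | e₁ , e₂ = subst (_∈ map (spoke (a , b)) allSpokes)
                (edge-cong (sym (+1-injective e₁)) (sym (trans (sym (lem q)) (cong _+1 e₂)))) (spoke∈ (a , b) k2)
  where
  lem : ∀ q → (q ℤ.+ -[1+ 0 ]) ℤ.+ + 1 ≡ q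
  lem = solve-∀

tail≢head : ∀ e → tailE e ≢ headE e
tail≢head ((p , q) , d0) eq = m+1≢m p (sym (proj₁ (,-injective eq)))
tail≢head ((p , q) , d1) eq = m+1≢m q (sym (proj₂ (,-injective eq)))
tail≢head ((p , q) , d2) eq = m+1≢m p (sym (proj₁ (,-injective eq)))

src≢dst : ∀ σ e → srcσ σ e ≢ dstσ σ e
src≢dst σ e eq with σ e
... | true = tail≢head e eq
... | false = tail≢head e (sym eq)

src⊎dst⇒incident : ∀ σ e z → srcσ σ e ≡ z ⊎ dstσ σ e ≡ z → tailE e ≡ z ⊎ headE e ≡ z
src⊎dst⇒incident σ e z h with σ e | h
... | true | inj₁ x = inj₁ x
... | true | inj₂ y = inj₂ y
... | false | inj₁ x = inj₂ x
... | false | inj₂ y = inj₁ y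

tail-outSpoke : ∀ w d → tailE (spoke w (d , true)) ≡ hub w
tail-outSpoke (a , b) d0 = refl
tail-outSpoke (a , b) d1 = refl
tail-outSpoke (a , b) d2 = refl

head-inSpoke : ∀ w d → headE (spoke w (d , false)) ≡ hub w
head-inSpoke (a , b) d0 = cong (λ x → (a +1 , x)) (ℤP.+-identityʳ _)
head-inSpoke (a , b) d1 = cong (λ x → (x , b +1)) (ℤP.+-identityʳ _)
head-inSpoke (a , b) d2 = cong (λ x → (a +1 , x)) (lem b)
  where
  lem : ∀ b → ((b ℤ.+ + 1) ℤ.+ + 1) ℤ.+ -[1+ 0 ] ≡ b ℤ.+ + 1
  lem = solve-∀

outward⇒src≡hub : ∀ σ w k → outward σ w k ≡ true → srcσ σ (spoke w k) ≡ hub w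
outward⇒src≡hub σ w (d , true) h with σ (spoke w (d , true))
... | true = tail-outSpoke w d
outward⇒src≡hub σ w (d , true) () | false
outward⇒src≡hub σ w (d , false) h with σ (spoke w (d , false))
... | false = head-inSpoke w d
outward⇒src≡hub σ w (d , false) () | true

inward⇒dst≡hub : ∀ σ w k → outward σ w k ≡ false → dstσ σ (spoke w k) ≡ hub w
inward⇒dst≡hub σ w (d , true) h with σ (spoke w (d , true))
... | false = tail-outSpoke w d
inward⇒dst≡hub σ w (d , true) () | true
inward⇒dst≡hub σ w (d , false) h with σ (spoke w (d , false))
... | true = head-inSpoke w d
inward⇒dst≡hub σ w (d , false) () | false

spoke-injective : ∀ w {k k′} → spoke w k ≡ spoke w k′ → k ≡ k′
spoke-injective w {d , b} {d′ , b′} eq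
  with trans (sym (spokeDir-spoke w (d , b))) (trans (cong proj₂ eq) (spokeDir-spoke w (d′ , b′)))
... | refl with b | b′
...   | true | true = refl
...   | false | false = refl
...   | true | false = ⊥-elim (tail≢head (spoke w (d , true))
                          (trans (tail-outSpoke w d) (sym (trans (cong headE eq) (head-inSpoke w d)))))
...   | false | true = ⊥-elim (tail≢head (spoke w (d , true))
                          (trans (tail-outSpoke w d) (sym (trans (cong headE (sym eq)) (head-inSpoke w d)))))

GEdges-unique : ∀ fs → Unique (GEdges fs)
GEdges-unique fs = deduplicate-! _

∈GEdges : ∀ {fs F e} → F ∈ fs → e ∈ faceEdges F → e ∈ GEdges fs
∈GEdges {fs} m me = ∈-deduplicate⁺ _≟E_ (∈concat fs m me)
  where
  ∈concat : ∀ fs {F e} → F ∈ fs → e ∈ faceEdges F → e ∈ concatMap faceEdges fs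
  ∈concat (F ∷ fs) (here refl) me = ∈-++⁺ˡ me
  ∈concat (F ∷ fs) (there m) me = ∈-++⁺ʳ (faceEdges F) (∈concat fs m me)

-- In-degree equals out-degree and the degree is at most 6, so at most three spokes point the same way.
module _ (fs : List Face) (σ : Ori) (eo : IsEO fs σ) (w : V) where

  private
    G = GEdges fs
    src? = λ e → srcσ σ e ≟V hub w
    dst? = λ e → dstσ σ e ≟V hub w
    S = filter src? G
    D = filter dst? G

  hub-degree≤6 : length S + length D ℕ.≤ 6
  hub-degree≤6 = ℕP.≤-trans (ℕP.≤-reflexive (sym (length-++ S)))
    (ℕP.≤-trans (Unique-⊆⇒length≤ (UniqueP.++⁺ (UniqueP.filter⁺ src? (GEdges-unique fs))
                                              (UniqueP.filter⁺ dst? (GEdges-unique fs)) disjoint) sub)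
                (ℕP.≤-reflexive (length-map (spoke w) allSpokes)))
    where
    disjoint : ∀ {e} → ¬ (e ∈ S × e ∈ D)
    disjoint {e} (mS , mD) = src≢dst σ e (trans (proj₂ (∈-filter⁻ src? {xs = G} mS)) (sym (proj₂ (∈-filter⁻ dst? {xs = G} mD))))
    sub : S ++ D ⊆ map (spoke w) allSpokes
    sub {e} m with ∈-++⁻ S m
    ... | inj₁ mS = incident⇒spoke w e (src⊎dst⇒incident σ e (hub w) (inj₁ (proj₂ (∈-filter⁻ src? {xs = G} mS))))
    ... | inj₂ mD = incident⇒spoke w e (src⊎dst⇒incident σ e (hub w) (inj₂ (proj₂ (∈-filter⁻ dst? {xs = G} mD))))

  side : Bool → List Edge
  side true = S
  side false = D

  alike-spokes-bound : ∀ b {ks} → Unique ks → All (λ k → spoke w k ∈ G × outward σ w k ≡ b) ks →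
                       length ks + length ks ℕ.≤ 6
  alike-spokes-bound b {ks} u alike = ℕP.≤-trans (ℕP.+-mono-≤ bound bound) (ℕP.≤-trans (both b) hub-degree≤6)
    where
    into-side : ∀ b → All (λ k → spoke w k ∈ G × outward σ w k ≡ b) ks → ∀ {k} → k ∈ ks → spoke w k ∈ side b
    into-side true alike m = ∈-filter⁺ src? (proj₁ (All.lookup alike m)) (outward⇒src≡hub σ w _ (proj₂ (All.lookup alike m)))
    into-side false alike m = ∈-filter⁺ dst? (proj₁ (All.lookup alike m)) (inward⇒dst≡hub σ w _ (proj₂ (All.lookup alike m)))
    bound : length ks ℕ.≤ length (side b)
    bound = ℕP.≤-trans (ℕP.≤-reflexive (sym (length-map (spoke w) ks)))
              (Unique-⊆⇒length≤ (UniqueP.map⁺ (spoke-injective w) u) sub)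
      where
      sub : map (spoke w) ks ⊆ side b
      sub m with ∈-map⁻ (spoke w) m
      ... | k , mk , refl = into-side b alike mk
    both : ∀ b → length (side b) + length (side b) ℕ.≤ length S + length D
    both true = ℕP.≤-reflexive (cong (λ n → length S + n) (sym (eo (hub w))))
    both false = ℕP.≤-reflexive (cong (λ n → n + length D) (eo (hub w)))

four-alike-spokes : ∀ fs σ w i₁ i₂ i₃ i₄ → IsEO fs σ → Unique (i₁ ∷ i₂ ∷ i₃ ∷ i₄ ∷ []) →
                    spoke w i₁ ∈ GEdges fs → spoke w i₂ ∈ GEdges fs → spoke w i₃ ∈ GEdges fs → spoke w i₄ ∈ GEdges fs →
                    outward σ w i₁ ≡ outward σ w i₂ → outward σ w i₁ ≡ outward σ w i₃ → outward σ w i₁ ≡ outward σ w i₄ → ⊥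
four-alike-spokes fs σ w i₁ i₂ i₃ i₄ eo u m₁ m₂ m₃ m₄ q₂ q₃ q₄
  with alike-spokes-bound fs σ eo w (outward σ w i₁) u ((m₁ , refl) ∷ (m₂ , sym q₂) ∷ (m₃ , sym q₃) ∷ (m₄ , sym q₄) ∷ [])
... | s≤s (s≤s (s≤s (s≤s (s≤s (s≤s ())))))

-- Blocked paths go straight

true≢false : true ≢ false
true≢false ()

next³ : Spoke → Spoke
next³ j = next (next (next j))

next⁴ : Spoke → Spoke
next⁴ j = next (next³ j)

consecutive4 : ∀ j → Unique (j ∷ next j ∷ next (next j) ∷ next³ j ∷ [])
consecutive4 k0 = ((λ ()) ∷ (λ ()) ∷ (λ ()) ∷ []) ∷ ((λ ()) ∷ (λ ()) ∷ []) ∷ ((λ ()) ∷ []) ∷ [] ∷ []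
consecutive4 k1 = ((λ ()) ∷ (λ ()) ∷ (λ ()) ∷ []) ∷ ((λ ()) ∷ (λ ()) ∷ []) ∷ ((λ ()) ∷ []) ∷ [] ∷ []
consecutive4 k2 = ((λ ()) ∷ (λ ()) ∷ (λ ()) ∷ []) ∷ ((λ ()) ∷ (λ ()) ∷ []) ∷ ((λ ()) ∷ []) ∷ [] ∷ []
consecutive4 k3 = ((λ ()) ∷ (λ ()) ∷ (λ ()) ∷ []) ∷ ((λ ()) ∷ (λ ()) ∷ []) ∷ ((λ ()) ∷ []) ∷ [] ∷ []
consecutive4 k4 = ((λ ()) ∷ (λ ()) ∷ (λ ()) ∷ []) ∷ ((λ ()) ∷ (λ ()) ∷ []) ∷ ((λ ()) ∷ []) ∷ [] ∷ []
consecutive4 k5 = ((λ ()) ∷ (λ ()) ∷ (λ ()) ∷ []) ∷ ((λ ()) ∷ (λ ()) ∷ []) ∷ ((λ ()) ∷ []) ∷ [] ∷ []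

spokes-0234 : ∀ j → Unique (j ∷ next (next j) ∷ next³ j ∷ next⁴ j ∷ [])
spokes-0234 k0 = ((λ ()) ∷ (λ ()) ∷ (λ ()) ∷ []) ∷ ((λ ()) ∷ (λ ()) ∷ []) ∷ ((λ ()) ∷ []) ∷ [] ∷ []
spokes-0234 k1 = ((λ ()) ∷ (λ ()) ∷ (λ ()) ∷ []) ∷ ((λ ()) ∷ (λ ()) ∷ []) ∷ ((λ ()) ∷ []) ∷ [] ∷ []
spokes-0234 k2 = ((λ ()) ∷ (λ ()) ∷ (λ ()) ∷ []) ∷ ((λ ()) ∷ (λ ()) ∷ []) ∷ ((λ ()) ∷ []) ∷ [] ∷ []
spokes-0234 k3 = ((λ ()) ∷ (λ ()) ∷ (λ ()) ∷ []) ∷ ((λ ()) ∷ (λ ()) ∷ []) ∷ ((λ ()) ∷ []) ∷ [] ∷ []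
spokes-0234 k4 = ((λ ()) ∷ (λ ()) ∷ (λ ()) ∷ []) ∷ ((λ ()) ∷ (λ ()) ∷ []) ∷ ((λ ()) ∷ []) ∷ [] ∷ []
spokes-0234 k5 = ((λ ()) ∷ (λ ()) ∷ (λ ()) ∷ []) ∷ ((λ ()) ∷ (λ ()) ∷ []) ∷ ((λ ()) ∷ []) ∷ [] ∷ []

spokes-0124 : ∀ j → Unique (j ∷ next j ∷ next (next j) ∷ next⁴ j ∷ [])
spokes-0124 k0 = ((λ ()) ∷ (λ ()) ∷ (λ ()) ∷ []) ∷ ((λ ()) ∷ (λ ()) ∷ []) ∷ ((λ ()) ∷ []) ∷ [] ∷ []
spokes-0124 k1 = ((λ ()) ∷ (λ ()) ∷ (λ ()) ∷ []) ∷ ((λ ()) ∷ (λ ()) ∷ []) ∷ ((λ ()) ∷ []) ∷ [] ∷ []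
spokes-0124 k2 = ((λ ()) ∷ (λ ()) ∷ (λ ()) ∷ []) ∷ ((λ ()) ∷ (λ ()) ∷ []) ∷ ((λ ()) ∷ []) ∷ [] ∷ []
spokes-0124 k3 = ((λ ()) ∷ (λ ()) ∷ (λ ()) ∷ []) ∷ ((λ ()) ∷ (λ ()) ∷ []) ∷ ((λ ()) ∷ []) ∷ [] ∷ []
spokes-0124 k4 = ((λ ()) ∷ (λ ()) ∷ (λ ()) ∷ []) ∷ ((λ ()) ∷ (λ ()) ∷ []) ∷ ((λ ()) ∷ []) ∷ [] ∷ []
spokes-0124 k5 = ((λ ()) ∷ (λ ()) ∷ (λ ()) ∷ []) ∷ ((λ ()) ∷ (λ ()) ∷ []) ∷ ((λ ()) ∷ []) ∷ [] ∷ []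

turn-ccw : ∀ fs σ → IsEO fs σ → ∀ w j g2 →
   sector w j ∈ fs → sector w (next j) ∈ fs → sector w (next (next j)) ∈ fs →
   isDirected σ (sector w j) ≡ false → isDirected σ (sector w (next j)) ≡ false → isDirected σ (sector w (next (next j))) ≡ false →
   blocking σ (sector w j) ≡ spoke w (next j) → blocking σ (sector w (next j)) ≡ spoke w (next (next j)) →
   blocking σ (sector w (next (next j))) ≡ g2 →
   proj₂ g2 ≡ spokeDir (next j) ⊎ g2 ≡ spoke w (next (next j))
turn-ccw fs σ eo w j g2 m0 m1 m2 n0 n1 n2 b0 b1 b2
  with ∈sector w (next (next j)) (subst (λ x → x ∈ faceEdges (sector w (next (next j)))) b2 (blocking∈ σ (sector w (next (next j)))))
... | inj₁ eq = inj₂ eq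
... | inj₂ (inj₂ eq) = inj₁ (trans (cong proj₂ eq) (trans (rimDir w (next (next j))) (spokeDir-next³ (next j))))
... | inj₂ (inj₁ eq) = ⊥-elim (four-alike-spokes fs σ w j (next j) (next (next j)) (next³ j) eo (consecutive4 j)
        (∈GEdges m0 (spoke∈sector w j)) (∈GEdges m0 (next-spoke∈sector w j))
        (∈GEdges m1 (next-spoke∈sector w (next j))) (∈GEdges m2 (next-spoke∈sector w (next (next j))))
        q1 (trans q1 q2) (trans q1 (trans q2 q3)))
  where
  q1 = blocked-at-spoke⇒outward≡ σ w j n0 (inj₂ b0)
  q2 = blocked-at-spoke⇒outward≡ σ w (next j) n1 (inj₂ b1)
  q3 = blocked-at-spoke⇒outward≡ σ w (next (next j)) n2 (inj₂ (trans b2 eq))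

turn-cw : ∀ fs σ → IsEO fs σ → ∀ w j g2 →
   sector w (next (next j)) ∈ fs → sector w (next j) ∈ fs → sector w j ∈ fs →
   isDirected σ (sector w (next (next j))) ≡ false → isDirected σ (sector w (next j)) ≡ false → isDirected σ (sector w j) ≡ false →
   blocking σ (sector w (next (next j))) ≡ spoke w (next (next j)) → blocking σ (sector w (next j)) ≡ spoke w (next j) →
   blocking σ (sector w j) ≡ g2 →
   proj₂ g2 ≡ spokeDir (next (next j)) ⊎ g2 ≡ spoke w (next j)
turn-cw fs σ eo w j g2 m0 m1 m2 n0 n1 n2 b0 b1 b2
  with ∈sector w j (subst (λ x → x ∈ faceEdges (sector w j)) b2 (blocking∈ σ (sector w j)))
... | inj₂ (inj₁ eq) = inj₂ eq
... | inj₂ (inj₂ eq) = inj₁ (trans (cong proj₂ eq) (rimDir w j))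
... | inj₁ eq = ⊥-elim (four-alike-spokes fs σ w j (next j) (next (next j)) (next³ j) eo (consecutive4 j)
        (∈GEdges m2 (spoke∈sector w j)) (∈GEdges m1 (spoke∈sector w (next j)))
        (∈GEdges m0 (spoke∈sector w (next (next j)))) (∈GEdges m0 (next-spoke∈sector w (next (next j))))
        q3 (trans q3 q2) (trans q3 (trans q2 q1)))
  where
  q1 = blocked-at-spoke⇒outward≡ σ w (next (next j)) n0 (inj₁ b0)
  q2 = blocked-at-spoke⇒outward≡ σ w (next j) n1 (inj₁ b1)
  q3 = blocked-at-spoke⇒outward≡ σ w j n2 (inj₁ (trans b2 eq))

blocked-path-straight : ∀ fs σ → IsEO fs σ → ∀ H0 H1 H2 g0 g1 g2 →
     H0 ∈ fs → H1 ∈ fs → H2 ∈ fs →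
     isDirected σ H0 ≡ false → isDirected σ H1 ≡ false → isDirected σ H2 ≡ false →
     blocking σ H0 ≡ g0 → blocking σ H1 ≡ g1 → blocking σ H2 ≡ g2 →
     across H0 g0 ≡ H1 → across H1 g1 ≡ H2 →
     proj₂ g2 ≡ proj₂ g0 ⊎ g1 ≡ g0 ⊎ g2 ≡ g1
blocked-path-straight fs σ eo H0 H1 H2 g0 g1 g2 m0 m1 m2 n0 n1 n2 b0 b1 b2 a0 a1 with g1 ≟E g0
... | yes eq = inj₂ (inj₁ eq)
... | no ne = main
  where
  g0∈H0 : g0 ∈ faceEdges H0
  g0∈H0 = subst (λ x → x ∈ faceEdges H0) b0 (blocking∈ σ H0)
  g0∈H1 : g0 ∈ faceEdges H1
  g0∈H1 = subst (λ F → g0 ∈ faceEdges F) a0 (∈-across H0 g0∈H0)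
  H0eq : across H1 g0 ≡ H0
  H0eq = trans (cong (λ F → across F g0) (sym a0)) (across-involutive H0 g0∈H0)
  g1∈H1 : g1 ∈ faceEdges H1
  g1∈H1 = subst (λ x → x ∈ faceEdges H1) b1 (blocking∈ σ H1)
  pp = ∈faceEdges⇒edgeAt H1 g0∈H1
  qq = ∈faceEdges⇒edgeAt H1 g1∈H1
  pq : proj₁ pp ≢ proj₁ qq
  pq e = ne (trans (proj₂ qq) (trans (cong (edgeAt H1) (sym e)) (sym (proj₂ pp))))
  main : proj₂ g2 ≡ proj₂ g0 ⊎ g1 ≡ g0 ⊎ g2 ≡ g1
  main with corner H1 (proj₁ pp) (proj₁ qq) pq
  ... | w , k , eqP , inj₁ (ea , eb) = caseA (prev k) (next-prev k)
    where
    caseA : ∀ j → next j ≡ k → proj₂ g2 ≡ proj₂ g0 ⊎ g1 ≡ g0 ⊎ g2 ≡ g1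
    caseA j refl = res
      where
      G0 : g0 ≡ spoke w (next j)
      G0 = trans (proj₂ pp) ea
      G1 : g1 ≡ spoke w (next (next j))
      G1 = trans (proj₂ qq) eb
      H0≡ : H0 ≡ sector w j
      H0≡ = trans (sym H0eq) (trans (cong₂ across eqP G0) (across-spoke w j))
      H2≡ : H2 ≡ sector w (next (next j))
      H2≡ = trans (sym a1) (trans (cong₂ across eqP G1) (across-next-spoke w (next j)))
      r = turn-ccw fs σ eo w j g2 (subst (_∈ fs) H0≡ m0) (subst (_∈ fs) eqP m1) (subst (_∈ fs) H2≡ m2)
            (trans (cong (isDirected σ) (sym H0≡)) n0) (trans (cong (isDirected σ) (sym eqP)) n1)
            (trans (cong (isDirected σ) (sym H2≡)) n2)
            (trans (cong (blocking σ) (sym H0≡)) (trans b0 G0))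
            (trans (cong (blocking σ) (sym eqP)) (trans b1 G1))
            (trans (cong (blocking σ) (sym H2≡)) b2)
      res : proj₂ g2 ≡ proj₂ g0 ⊎ g1 ≡ g0 ⊎ g2 ≡ g1
      res with r
      ... | inj₁ d = inj₁ (trans d (trans (sym (spokeDir-spoke w (next j))) (cong proj₂ (sym G0))))
      ... | inj₂ e = inj₂ (inj₂ (trans e (sym G1)))
  ... | w , k , eqP , inj₂ (ea , eb) = caseB (prev k) (next-prev k)
    where
    caseB : ∀ j → next j ≡ k → proj₂ g2 ≡ proj₂ g0 ⊎ g1 ≡ g0 ⊎ g2 ≡ g1
    caseB j refl = res
      where
      G0 : g0 ≡ spoke w (next (next j))
      G0 = trans (proj₂ pp) ea
      G1 : g1 ≡ spoke w (next j)
      G1 = trans (proj₂ qq) eb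
      H0≡ : H0 ≡ sector w (next (next j))
      H0≡ = trans (sym H0eq) (trans (cong₂ across eqP G0) (across-next-spoke w (next j)))
      H2≡ : H2 ≡ sector w j
      H2≡ = trans (sym a1) (trans (cong₂ across eqP G1) (across-spoke w j))
      r = turn-cw fs σ eo w j g2 (subst (_∈ fs) H0≡ m0) (subst (_∈ fs) eqP m1) (subst (_∈ fs) H2≡ m2)
            (trans (cong (isDirected σ) (sym H0≡)) n0) (trans (cong (isDirected σ) (sym eqP)) n1)
            (trans (cong (isDirected σ) (sym H2≡)) n2)
            (trans (cong (blocking σ) (sym H0≡)) (trans b0 G0))
            (trans (cong (blocking σ) (sym eqP)) (trans b1 G1))
            (trans (cong (blocking σ) (sym H2≡)) b2)
      res : proj₂ g2 ≡ proj₂ g0 ⊎ g1 ≡ g0 ⊎ g2 ≡ g1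
      res with r
      ... | inj₁ d = inj₁ (trans d (trans (sym (spokeDir-spoke w (next (next j)))) (cong proj₂ (sym G0))))
      ... | inj₂ e = inj₂ (inj₂ (trans e (sym G1)))


-- A directed sector, then one blocked at its rim and one blocked at its far spoke, entered from Q in the
-- direction of that rim: four of the spokes would point the same way.
approach-ccw : ∀ fs σ → IsEO fs σ → ∀ w j g Q →
   sector w j ∈ fs → sector w (next (next j)) ∈ fs → Q ∈ fs →
   isDirected σ (sector w j) ≡ true → isDirected σ (sector w (next j)) ≡ false →
   isDirected σ (sector w (next (next j))) ≡ false → isDirected σ Q ≡ false →
   blocking σ (sector w (next j)) ≡ rim w (next j) →
   blocking σ (sector w (next (next j))) ≡ spoke w (next (next j)) →
   g ∈ faceEdges (sector w (next (next j))) → blocking σ Q ≡ g → across (sector w (next (next j))) g ≡ Q →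
   proj₂ g ≡ spokeDir j → ⊥
approach-ccw fs σ eo w j g Q mA mX mQ dA nB nX nQ bB bX g∈ bQ aQ dg with ∈sector w (next (next j)) g∈
... | inj₁ eq = spokeDir-next² j (sym (trans (sym (trans (cong proj₂ eq) (spokeDir-spoke w (next (next j))))) dg))
... | inj₂ (inj₂ eq) =
  spokeDir-next j (sym (trans (sym (trans (cong proj₂ eq) (trans (rimDir w (next (next j))) (spokeDir-next³ (next j))))) dg))
... | inj₂ (inj₁ refl) = four-alike-spokes fs σ w j (next (next j)) (next³ j) (next⁴ j) eo (spokes-0234 j)
        (∈GEdges mA (spoke∈sector w j)) (∈GEdges mX (spoke∈sector w (next (next j))))
        (∈GEdges mX (next-spoke∈sector w (next (next j)))) (∈GEdges mQ′ (next-spoke∈sector w (next³ j)))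
        q12 (trans q12 q3) (trans q12 (trans q3 q4))
  where
  Q≡ : Q ≡ sector w (next³ j)
  Q≡ = trans (sym aQ) (across-next-spoke w (next (next j)))
  mQ′ = subst (_∈ fs) Q≡ mQ
  q1 = directed⇒outward≢ σ w j dA
  q2 = blocked-at-rim⇒outward≢ σ w (next j) nB bB
  q12 : outward σ w j ≡ outward σ w (next (next j))
  q12 = trans q1 (trans (cong not q2) (not-involutive _))
  q3 = blocked-at-spoke⇒outward≡ σ w (next (next j)) nX (inj₁ bX)
  q4 = blocked-at-spoke⇒outward≡ σ w (next³ j) (trans (cong (isDirected σ) (sym Q≡)) nQ) (inj₁ (trans (cong (blocking σ) (sym Q≡)) bQ))

approach-cw : ∀ fs σ → IsEO fs σ → ∀ w j g Q →
   sector w (next³ j) ∈ fs → sector w (next j) ∈ fs → Q ∈ fs →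
   isDirected σ (sector w (next³ j)) ≡ true → isDirected σ (sector w (next (next j))) ≡ false →
   isDirected σ (sector w (next j)) ≡ false → isDirected σ Q ≡ false →
   blocking σ (sector w (next (next j))) ≡ rim w (next (next j)) →
   blocking σ (sector w (next j)) ≡ spoke w (next (next j)) →
   g ∈ faceEdges (sector w (next j)) → blocking σ Q ≡ g → across (sector w (next j)) g ≡ Q →
   proj₂ g ≡ spokeDir (next j) → ⊥
approach-cw fs σ eo w j g Q mA mX mQ dA nB nX nQ bB bX g∈ bQ aQ dg with ∈sector w (next j) g∈
... | inj₂ (inj₁ eq) = spokeDir-next (next j) (sym (trans (sym (trans (cong proj₂ eq) (spokeDir-spoke w (next (next j))))) dg))
... | inj₂ (inj₂ eq) = spokeDir-next j (trans (sym (trans (cong proj₂ eq) (trans (rimDir w (next j)) (spokeDir-next³ j)))) dg)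
... | inj₁ refl = four-alike-spokes fs σ w j (next j) (next (next j)) (next⁴ j) eo (spokes-0124 j)
        (∈GEdges mQ′ (spoke∈sector w j)) (∈GEdges mQ′ (next-spoke∈sector w j))
        (∈GEdges mX (next-spoke∈sector w (next j))) (∈GEdges mA (next-spoke∈sector w (next³ j)))
        q4 (trans q4 q3) (trans q4 (trans q3 q12))
  where
  Q≡ : Q ≡ sector w j
  Q≡ = trans (sym aQ) (across-spoke w j)
  mQ′ = subst (_∈ fs) Q≡ mQ
  q1 = directed⇒outward≢ σ w (next³ j) dA
  q2 = blocked-at-rim⇒outward≢ σ w (next (next j)) nB bB
  q12 : outward σ w (next (next j)) ≡ outward σ w (next⁴ j)
  q12 = trans q2 (trans (cong not q1) (not-involutive _))
  q3 = blocked-at-spoke⇒outward≡ σ w (next j) nX (inj₂ bX)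
  q4 = blocked-at-spoke⇒outward≡ σ w j (trans (cong (isDirected σ) (sym Q≡)) nQ) (inj₂ (trans (cong (blocking σ) (sym Q≡)) bQ))

next-next-prev-prev : ∀ k → next (next (prev (prev k))) ≡ k
next-next-prev-prev k = trans (cong next (next-prev (prev k))) (next-prev k)

no-straight-approach : ∀ fs σ → IsEO fs σ → ∀ A B Xf Q e b x g →
   A ∈ fs → B ∈ fs → Xf ∈ fs → Q ∈ fs →
   isDirected σ A ≡ true → isDirected σ B ≡ false → isDirected σ Xf ≡ false → isDirected σ Q ≡ false →
   e ∈ faceEdges A → e ∈ faceEdges B → blocking σ B ≡ b → e ≢ b →
   x ∈ faceEdges B → x ≢ e → x ≢ b → across B x ≡ Xf → blocking σ Xf ≡ x →
   blocking σ Q ≡ g → across Q g ≡ Xf → proj₂ g ≡ proj₂ b → ⊥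
no-straight-approach fs σ eo A B Xf Q e b x g mA mB mX mQ dA nB nX nQ eA eB bB eb xB xe xb aX bX bQ aQ dg = main
  where
  pe = ∈faceEdges⇒edgeAt B eB
  px = ∈faceEdges⇒edgeAt B xB
  pq : proj₁ pe ≢ proj₁ px
  pq h = xe (trans (proj₂ px) (trans (cong (edgeAt B) (sym h)) (sym (proj₂ pe))))
  A≡ : A ≡ across B e
  A≡ with shared-edge B A eB eA
  ... | inj₁ h = ⊥-elim (true≢false (trans (sym dA) (trans (cong (isDirected σ) h) nB)))
  ... | inj₂ h = h
  b∈ : b ∈ faceEdges B
  b∈ = subst (λ y → y ∈ faceEdges B) bB (blocking∈ σ B)
  g∈Q : g ∈ faceEdges Q
  g∈Q = subst (λ y → y ∈ faceEdges Q) bQ (blocking∈ σ Q)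
  g∈X : g ∈ faceEdges Xf
  g∈X = subst (λ F → g ∈ faceEdges F) aQ (∈-across Q g∈Q)
  Q≡ : across Xf g ≡ Q
  Q≡ = trans (cong (λ F → across F g) (sym aQ)) (across-involutive Q g∈Q)
  main : ⊥
  main with corner B (proj₁ pe) (proj₁ px) pq
  ... | w , k , eqB , inj₁ (ea , eb′) = caseA (prev k) (next-prev k)
    where
    caseA : ∀ j → next j ≡ k → ⊥
    caseA j refl = res
      where
      E0 : e ≡ spoke w (next j)
      E0 = trans (proj₂ pe) ea
      X0 : x ≡ spoke w (next (next j))
      X0 = trans (proj₂ px) eb′
      A′ : A ≡ sector w j
      A′ = trans A≡ (trans (cong₂ across eqB E0) (across-spoke w j))
      X′ : Xf ≡ sector w (next (next j))
      X′ = trans (sym aX) (trans (cong₂ across eqB X0) (across-next-spoke w (next j)))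
      bF : b ≡ rim w (next j)
      bF with ∈sector w (next j) (subst (λ F → b ∈ faceEdges F) eqB b∈)
      ... | inj₁ h = ⊥-elim (eb (trans E0 (sym h)))
      ... | inj₂ (inj₁ h) = ⊥-elim (xb (trans X0 (sym h)))
      ... | inj₂ (inj₂ h) = h
      res : ⊥
      res = approach-ccw fs σ eo w j g Q (subst (_∈ fs) A′ mA) (subst (_∈ fs) X′ mX) mQ
              (trans (cong (isDirected σ) (sym A′)) dA) (trans (cong (isDirected σ) (sym eqB)) nB)
              (trans (cong (isDirected σ) (sym X′)) nX) nQ
              (trans (cong (blocking σ) (sym eqB)) (trans bB bF))
              (trans (cong (blocking σ) (sym X′)) (trans bX X0))
              (subst (λ F → g ∈ faceEdges F) X′ g∈X) bQ
              (trans (cong (λ F → across F g) (sym X′)) Q≡)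
              (trans dg (trans (cong proj₂ bF) (trans (rimDir w (next j)) (spokeDir-next³ j))))
  ... | w , k , eqB , inj₂ (ea , eb′) = caseB (prev (prev k)) (next-next-prev-prev k)
    where
    caseB : ∀ j → next (next j) ≡ k → ⊥
    caseB j refl = res
      where
      E0 : e ≡ spoke w (next³ j)
      E0 = trans (proj₂ pe) ea
      X0 : x ≡ spoke w (next (next j))
      X0 = trans (proj₂ px) eb′
      A′ : A ≡ sector w (next³ j)
      A′ = trans A≡ (trans (cong₂ across eqB E0) (across-next-spoke w (next (next j))))
      X′ : Xf ≡ sector w (next j)
      X′ = trans (sym aX) (trans (cong₂ across eqB X0) (across-spoke w (next j)))
      bF : b ≡ rim w (next (next j))
      bF with ∈sector w (next (next j)) (subst (λ F → b ∈ faceEdges F) eqB b∈)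
      ... | inj₁ h = ⊥-elim (xb (trans X0 (sym h)))
      ... | inj₂ (inj₁ h) = ⊥-elim (eb (trans E0 (sym h)))
      ... | inj₂ (inj₂ h) = h
      res : ⊥
      res = approach-cw fs σ eo w j g Q (subst (_∈ fs) A′ mA) (subst (_∈ fs) X′ mX) mQ
              (trans (cong (isDirected σ) (sym A′)) dA) (trans (cong (isDirected σ) (sym eqB)) nB)
              (trans (cong (isDirected σ) (sym X′)) nX) nQ
              (trans (cong (blocking σ) (sym eqB)) (trans bB bF))
              (trans (cong (blocking σ) (sym X′)) (trans bX X0))
              (subst (λ F → g ∈ faceEdges F) X′ g∈X) bQ
              (trans (cong (λ F → across F g) (sym X′)) Q≡)
              (trans dg (trans (cong proj₂ bF) (trans (rimDir w (next (next j))) (spokeDir-next³ (next j)))))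



-- Towers

nextFace : Ori → Face → Face
nextFace σ F = across F (blocking σ F)

data Tower (fs : List Face) (σ : Ori) : List Face → Set where
  top : ∀ {F} → F ∈ fs → isDirected σ F ≡ true → Tower fs σ (F ∷ [])
  climb : ∀ {F G T} → F ∈ fs → isDirected σ F ≡ false → nextFace σ F ≡ G → Tower fs σ (G ∷ T) →
         Tower fs σ (F ∷ G ∷ T)

memB-true⇒∈ : ∀ {F fs} → memB _≟F_ F fs ≡ true → F ∈ fs
memB-true⇒∈ {F} {fs} h with F ∈F? fs
... | yes m = m
memB-true⇒∈ () | no _

towerGo-sound : ∀ fs σ n F {T} → towerGo fs σ n F ≡ just T → Tower fs σ T × ∃ λ T′ → T ≡ F ∷ T′
towerGo-sound fs σ n F h with memB _≟F_ F fs in mF | isDirected σ F in dF | n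
towerGo-sound fs σ n F () | false | _ | _
towerGo-sound fs σ n F refl | true | true | _ = top (memB-true⇒∈ mF) dF , [] , refl
towerGo-sound fs σ n F () | true | false | zero
towerGo-sound fs σ n F h | true | false | suc m with towerGo fs σ m (nextFace σ F) in rest
towerGo-sound fs σ n F refl | true | false | suc m | just T′ with towerGo-sound fs σ m (nextFace σ F) rest
... | tower , T″ , refl = climb (memB-true⇒∈ mF) dF refl tower , _ , refl
towerGo-sound fs σ n F () | true | false | suc m | nothing

tower-sound : ∀ fs σ F {T} → tower fs σ F ≡ just T → Tower fs σ T × ∃ λ T′ → T ≡ F ∷ T′
tower-sound fs σ F = towerGo-sound fs σ (length fs) F

module _ {fs : List Face} {σ : Ori} {B Y : Face} (nB : isDirected σ B ≡ false) (nY : isDirected σ Y ≡ false)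
         (B→Y : nextFace σ B ≡ Y) (Y→B : nextFace σ Y ≡ B) where

  two-cycle-blocks-tower : ∀ {T} → Tower fs σ (B ∷ T) → ⊥
  two-cycle-blocks-tower = fromB refl
    where
    fromB : ∀ {C T} → C ≡ B → Tower fs σ (C ∷ T) → ⊥
    fromY : ∀ {C T} → C ≡ Y → Tower fs σ (C ∷ T) → ⊥
    fromB refl (top _ d) = true≢false (trans (sym d) nB)
    fromB refl (climb _ _ e rest) = fromY (trans (sym e) B→Y) rest
    fromY refl (top _ d) = true≢false (trans (sym d) nY)
    fromY refl (climb _ _ e rest) = fromB (trans (sym e) Y→B) rest

  two-cycle⇒tower≡nothing : tower fs σ B ≡ nothing
  two-cycle⇒tower≡nothing with tower fs σ B in t
  ... | nothing = refl
  ... | just T with tower-sound fs σ B t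
  ...   | tw , _ , refl = ⊥-elim (two-cycle-blocks-tower tw)

-- How a tower from F ≢ B enters B: from a blocked face P, which is F or is itself entered from a blocked Q.
Predecessor : List Face → Ori → Face → Face → Set
Predecessor fs σ F B = ∃ λ P → P ∈ fs × isDirected σ P ≡ false × nextFace σ P ≡ B × (∃ λ T → Tower fs σ (B ∷ T)) ×
                       (F ≡ P ⊎ ∃ λ Q → Q ∈ fs × isDirected σ Q ≡ false × nextFace σ Q ≡ P)

tower-predecessor : ∀ {fs σ F T B} → Tower fs σ (F ∷ T) → B ∈ F ∷ T → F ≢ B → Predecessor fs σ F B
tower-predecessor _ (here refl) F≢B = ⊥-elim (F≢B refl)
tower-predecessor (top _ _) (there ()) _
tower-predecessor {F = F} {B = B} (climb {G = G} mF nF eF rest) (there m) _ with G ≟F B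
... | yes refl = F , mF , nF , eF , (_ , rest) , inj₁ refl
... | no G≢B with tower-predecessor rest m G≢B
...   | P , mP , nP , eP , tw , inj₁ refl = P , mP , nP , eP , tw , inj₂ (F , mF , nF , eF)
...   | P , mP , nP , eP , tw , inj₂ q = P , mP , nP , eP , tw , inj₂ q

memB-∈ : ∀ {e xs} → e ∈ xs → memB _≟E_ e xs ≡ true
memB-∈ {e} {xs} m with e ∈E? xs
... | yes _ = refl
... | no e∉xs = ⊥-elim (e∉xs m)

memB-∉ : ∀ {e xs} → e ∉ xs → memB _≟E_ e xs ≡ false
memB-∉ {e} {xs} e∉xs with e ∈E? xs
... | yes m = ⊥-elim (e∉xs m)
... | no _ = refl

reverseFace : Face → Ori → Ori
reverseFace F ρ = reverseFaces (F ∷ []) ρ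

reverseFace-∈ : ∀ F ρ {e} → e ∈ faceEdges F → reverseFace F ρ e ≡ not (ρ e)
reverseFace-∈ F ρ {e} m rewrite memB-∈ {e} {faceEdges F} m = BoolP.xor-comm (ρ e) true

reverseFace-∉ : ∀ F ρ {e} → e ∉ faceEdges F → reverseFace F ρ e ≡ ρ e
reverseFace-∉ F ρ {e} e∉F rewrite memB-∉ {e} {faceEdges F} e∉F = xor-identityʳ _

xor-cancelʳ : ∀ a b → (a xor b) xor b ≡ a
xor-cancelʳ a b = trans (xor-assoc a b b) (trans (cong (a xor_) (xor-same b)) (xor-identityʳ a))

reverseFace-involutive : ∀ F ρ e → reverseFace F (reverseFace F ρ) e ≡ ρ e
reverseFace-involutive F ρ e = xor-cancelʳ (ρ e) _

Agree-sym : ∀ {fs ρ ρ′} → Agree fs ρ ρ′ → Agree fs ρ′ ρ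
Agree-sym ag e m = sym (ag e m)

Agree-trans : ∀ {fs ρ ρ′ ρ″} → Agree fs ρ ρ′ → Agree fs ρ′ ρ″ → Agree fs ρ ρ″
Agree-trans a b e m = trans (a e m) (b e m)

Agree-reverseFace : ∀ {fs ρ ρ′} F → Agree fs ρ ρ′ → Agree fs (reverseFace F ρ) (reverseFace F ρ′)
Agree-reverseFace F ag e m = cong (_xor _) (ag e m)

AgreeOn : Face → Ori → Ori → Set
AgreeOn F ρ ρ′ = ∀ e → e ∈ faceEdges F → ρ e ≡ ρ′ e

ccwAt-cong : ∀ {ρ ρ′ F} → AgreeOn F ρ ρ′ → ∀ p → ccwAt ρ F p ≡ ccwAt ρ′ F p
ccwAt-cong {F = F} ag p = cong (λ b → not (b xor proj₂ (sideAt F p))) (ag (edgeAt F p) (edgeAt∈ F p))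

isDirected-cong : ∀ {ρ ρ′ F} → AgreeOn F ρ ρ′ → isDirected ρ F ≡ isDirected ρ′ F
isDirected-cong {ρ} {ρ′} {F} ag rewrite isDirected≡allEqual ρ F | isDirected≡allEqual ρ′ F
  | ccwAt-cong {ρ} {ρ′} {F} ag P1 | ccwAt-cong {ρ} {ρ′} {F} ag P2 | ccwAt-cong {ρ} {ρ′} {F} ag P3 = refl

blocking-cong : ∀ {ρ ρ′ F} → AgreeOn F ρ ρ′ → blocking ρ F ≡ blocking ρ′ F
blocking-cong {ρ} {ρ′} {F} ag rewrite blocking≡edgeAt ρ F | blocking≡edgeAt ρ′ F
  | ccwAt-cong {ρ} {ρ′} {F} ag P1 | ccwAt-cong {ρ} {ρ′} {F} ag P2 | ccwAt-cong {ρ} {ρ′} {F} ag P3 = refl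

Agree⇒AgreeOn : ∀ {fs ρ ρ′ F} → F ∈ fs → Agree fs ρ ρ′ → AgreeOn F ρ ρ′
Agree⇒AgreeOn mF ag e me = ag e (∈GEdges mF me)

ccw-flipped : ∀ ρ ρ′ e fl → ρ′ e ≡ not (ρ e) → ccw ρ′ (e , fl) ≡ not (ccw ρ (e , fl))
ccw-flipped ρ ρ′ e fl h rewrite h with ρ e | fl
... | true | true = refl
... | true | false = refl
... | false | true = refl
... | false | false = refl

ccwAt-reverseFace : ∀ F ρ p → ccwAt (reverseFace F ρ) F p ≡ not (ccwAt ρ F p)
ccwAt-reverseFace F ρ p = ccw-flipped ρ (reverseFace F ρ) (edgeAt F p) _ (reverseFace-∈ F ρ (edgeAt∈ F p))

allEqual-not : ∀ a b c → allEqual (not a) (not b) (not c) ≡ allEqual a b c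
allEqual-not true true true = refl
allEqual-not true true false = refl
allEqual-not true false true = refl
allEqual-not true false false = refl
allEqual-not false true true = refl
allEqual-not false true false = refl
allEqual-not false false true = refl
allEqual-not false false false = refl

isDirected-reverseFace : ∀ F ρ → isDirected (reverseFace F ρ) F ≡ isDirected ρ F
isDirected-reverseFace F ρ rewrite isDirected≡allEqual (reverseFace F ρ) F | isDirected≡allEqual ρ F
  | ccwAt-reverseFace F ρ P1 | ccwAt-reverseFace F ρ P2 | ccwAt-reverseFace F ρ P3 =
  allEqual-not (ccwAt ρ F P1) (ccwAt ρ F P2) (ccwAt ρ F P3)

FlipPath-respˡ : ∀ {fs ρ ρ′ τ n} → Agree fs ρ ρ′ → FlipPath fs ρ′ τ n → FlipPath fs ρ τ n
FlipPath-respˡ {fs} ag (done ag′) = done (Agree-trans {fs} ag ag′)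
FlipPath-respˡ {fs} {ρ} {ρ′} ag (flip F m d rest) =
  flip F m (trans (isDirected-cong {ρ} {ρ′} {F} (Agree⇒AgreeOn {fs} m ag)) d)
    (FlipPath-respˡ (Agree-reverseFace {fs} {ρ} {ρ′} F ag) rest)

FlipPath-++ : ∀ {fs σ ρ τ n k} → FlipPath fs σ ρ n → FlipPath fs ρ τ k → FlipPath fs σ τ (n + k)
FlipPath-++ (done ag) p = FlipPath-respˡ ag p
FlipPath-++ (flip F m d rest) p = flip F m d (FlipPath-++ rest p)

FlipPath-single : ∀ {fs ρ} F → F ∈ fs → isDirected ρ F ≡ true → FlipPath fs (reverseFace F ρ) ρ 1
FlipPath-single {fs} {ρ} F m d =
  flip F m (trans (isDirected-reverseFace F ρ) d) (done (λ e _ → reverseFace-involutive F ρ e))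

FlipPath-sym : ∀ {fs σ τ n} → FlipPath fs σ τ n → FlipPath fs τ σ n
FlipPath-sym {fs} (done ag) = done (Agree-sym {fs} ag)
FlipPath-sym {n = suc n} (flip F m d rest) =
  subst (FlipPath _ _ _) (ℕP.+-comm n 1) (FlipPath-++ (FlipPath-sym rest) (FlipPath-single F m d))

count-map : ∀ {P : Pred V 0ℓ} (P? : Decidable P) (g : Edge → V) xs →
            count (λ e → P? (g e)) xs ≡ count P? (map g xs)
count-map P? g [] = refl
count-map P? g (x ∷ xs) with P? (g x)
... | yes _ = cong suc (count-map P? g xs)
... | no _ = count-map P? g xs

count-++ : ∀ {A : Set} {P : Pred A 0ℓ} (P? : Decidable P) xs ys → count P? (xs ++ ys) ≡ count P? xs + count P? ys
count-++ P? xs ys = trans (cong length (filter-++ P? xs ys)) (length-++ (filter P? xs))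

count-rotate : ∀ {P : Pred V 0ℓ} (P? : Decidable P) x y z → count P? (x ∷ y ∷ z ∷ []) ≡ count P? (y ∷ z ∷ x ∷ [])
count-rotate P? x y z =
  trans (count-++ P? (x ∷ []) (y ∷ z ∷ [])) (trans (ℕP.+-comm (count P? (x ∷ [])) (count P? (y ∷ z ∷ [])))
    (sym (count-++ P? (y ∷ z ∷ []) (x ∷ []))))

vertex-cong : ∀ {a b c d : ℤ} → a ≡ c → b ≡ d → (a , b) ≡ (c , d)
vertex-cong refl refl = refl

-- Around a directed triangle the heads of its sides are a rotation of their tails.
directed-balanced : ∀ ρ F v → isDirected ρ F ≡ true →
                    count (λ e → srcσ ρ e ≟V v) (faceEdges F) ≡ count (λ e → dstσ ρ e ≟V v) (faceEdges F)
directed-balanced ρ F v d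
  rewrite count-map (_≟V v) (srcσ ρ) (faceEdges F) | count-map (_≟V v) (dstσ ρ) (faceEdges F) = cyclic F d
  where
  +0 : ∀ x → x ℤ.+ + 0 ≡ x
  +0 = solve-∀
  +1-1 : ∀ x → (x ℤ.+ + 1) ℤ.+ -[1+ 0 ] ≡ x
  +1-1 = solve-∀
  forward : ∀ a b c a′ b′ c′ → a ≡ a′ → b ≡ b′ → c ≡ c′ →
            count (_≟V v) (a ∷ b ∷ c ∷ []) ≡ count (_≟V v) (b′ ∷ c′ ∷ a′ ∷ [])
  forward a b c _ _ _ refl refl refl = count-rotate (_≟V v) a b c
  backward : ∀ a b c a′ b′ c′ → a ≡ a′ → b ≡ b′ → c ≡ c′ →
             count (_≟V v) (a ∷ b ∷ c ∷ []) ≡ count (_≟V v) (c′ ∷ a′ ∷ b′ ∷ [])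
  backward a b c _ _ _ refl refl refl = sym (count-rotate (_≟V v) c a b)
  cyclic : ∀ F → isDirected ρ F ≡ true → count (_≟V v) (map (srcσ ρ) (faceEdges F)) ≡ count (_≟V v) (map (dstσ ρ) (faceEdges F))
  cyclic (up (i , j)) d with ρ ((i , j) , d0) | ρ ((i , j ℤ.+ + 1) , d2) | ρ ((i , j) , d1)
  cyclic (up (i , j)) d | true | false | false =
    forward (i , j) (i ℤ.+ + 1 , (j ℤ.+ + 1) ℤ.+ -[1+ 0 ]) (i ℤ.+ + 0 , j ℤ.+ + 1)
            (i , j) (i ℤ.+ + 1 , j ℤ.+ + 0) (i , j ℤ.+ + 1)
            refl (vertex-cong refl (trans (+1-1 j) (sym (+0 j)))) (vertex-cong (+0 i) refl)
  cyclic (up (i , j)) d | false | true | true =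
    backward (i ℤ.+ + 1 , j ℤ.+ + 0) (i , j ℤ.+ + 1) (i , j)
             (i ℤ.+ + 1 , (j ℤ.+ + 1) ℤ.+ -[1+ 0 ]) (i ℤ.+ + 0 , j ℤ.+ + 1) (i , j)
             (vertex-cong refl (trans (+0 j) (sym (+1-1 j)))) (vertex-cong (sym (+0 i)) refl) refl
  cyclic (up (i , j)) () | true | true | true
  cyclic (up (i , j)) () | true | true | false
  cyclic (up (i , j)) () | true | false | true
  cyclic (up (i , j)) () | false | true | false
  cyclic (up (i , j)) () | false | false | true
  cyclic (up (i , j)) () | false | false | false
  cyclic (down (i , j)) d with ρ ((i ℤ.+ + 1 , j) , d1) | ρ ((i , j ℤ.+ + 1) , d0) | ρ ((i , j ℤ.+ + 1) , d2)
  cyclic (down (i , j)) d | true | false | true =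
    forward (i ℤ.+ + 1 , j) (i ℤ.+ + 1 , (j ℤ.+ + 1) ℤ.+ + 0) (i , j ℤ.+ + 1)
            (i ℤ.+ + 1 , (j ℤ.+ + 1) ℤ.+ -[1+ 0 ]) ((i ℤ.+ + 1) ℤ.+ + 0 , j ℤ.+ + 1) (i , j ℤ.+ + 1)
            (vertex-cong refl (sym (+1-1 j))) (vertex-cong (sym (+0 _)) (+0 _)) refl
  cyclic (down (i , j)) d | false | true | false =
    backward ((i ℤ.+ + 1) ℤ.+ + 0 , j ℤ.+ + 1) (i , j ℤ.+ + 1) (i ℤ.+ + 1 , (j ℤ.+ + 1) ℤ.+ -[1+ 0 ])
             (i ℤ.+ + 1 , (j ℤ.+ + 1) ℤ.+ + 0) (i , j ℤ.+ + 1) (i ℤ.+ + 1 , j)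
             (vertex-cong (+0 _) (sym (+0 _))) refl (vertex-cong refl (+1-1 j))
  cyclic (down (i , j)) () | true | true | true
  cyclic (down (i , j)) () | true | true | false
  cyclic (down (i , j)) () | true | false | false
  cyclic (down (i , j)) () | false | true | true
  cyclic (down (i , j)) () | false | false | true
  cyclic (down (i , j)) () | false | false | false

faceEdges-unique : ∀ F → Unique (faceEdges F)
faceEdges-unique (up _) = ((λ ()) ∷ (λ ()) ∷ []) ∷ ((λ ()) ∷ []) ∷ [] ∷ []
faceEdges-unique (down _) = ((λ ()) ∷ (λ ()) ∷ []) ∷ ((λ ()) ∷ []) ∷ [] ∷ []

count-≐ : ∀ {A : Set} {P Q : Pred A 0ℓ} (P? : Decidable P) (Q? : Decidable Q) {xs} → Unique xs →
          (∀ {x} → x ∈ xs → P x → Q x) → (∀ {x} → x ∈ xs → Q x → P x) → count P? xs ≡ count Q? xs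
count-≐ P? Q? u to from = count-cong P? Q? u u (λ (m , p) → m , to m p) (λ (m , q) → m , from m q)

dst-same : ∀ ρ ρ′ x → ρ′ x ≡ ρ x → dstσ ρ′ x ≡ dstσ ρ x
dst-same ρ ρ′ x h rewrite h = refl

src-same : ∀ ρ ρ′ x → ρ′ x ≡ ρ x → srcσ ρ′ x ≡ srcσ ρ x
src-same ρ ρ′ x h rewrite h = refl

dst-flipped : ∀ ρ ρ′ x → ρ′ x ≡ not (ρ x) → dstσ ρ′ x ≡ srcσ ρ x
dst-flipped ρ ρ′ x h rewrite h with ρ x
... | true = refl
... | false = refl

src-flipped : ∀ ρ ρ′ x → ρ′ x ≡ not (ρ x) → srcσ ρ′ x ≡ dstσ ρ x
src-flipped ρ ρ′ x h rewrite h with ρ x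
... | true = refl
... | false = refl

IsEO-reverseFace : ∀ fs ρ F → IsEO fs ρ → F ∈ fs → isDirected ρ F ≡ true → IsEO fs (reverseFace F ρ)
IsEO-reverseFace fs ρ F eo mF dF v = begin
  In ρ′ G                 ≡⟨ split (In? ρ′) ⟩
  In ρ′ S + In ρ′ N       ≡⟨ cong₂ _+_ (count-≐ (In? ρ′) (Out? ρ) uS (λ m → trans (sym (dst-flipped ρ ρ′ _ (flipped m))))
                                                                (λ m → trans (dst-flipped ρ ρ′ _ (flipped m))))
                                       (count-≐ (In? ρ′) (In? ρ) uN (λ m → trans (sym (dst-same ρ ρ′ _ (unchanged m))))
                                                                (λ m → trans (dst-same ρ ρ′ _ (unchanged m)))) ⟩
  Out ρ S + In ρ N        ≡⟨ cong₂ _+_ balanced N-balanced ⟩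
  In ρ S + Out ρ N        ≡⟨ sym (cong₂ _+_ (count-≐ (Out? ρ′) (In? ρ) uS (λ m → trans (sym (src-flipped ρ ρ′ _ (flipped m))))
                                                                     (λ m → trans (src-flipped ρ ρ′ _ (flipped m))))
                                            (count-≐ (Out? ρ′) (Out? ρ) uN (λ m → trans (sym (src-same ρ ρ′ _ (unchanged m))))
                                                                     (λ m → trans (src-same ρ ρ′ _ (unchanged m))))) ⟩
  Out ρ′ S + Out ρ′ N     ≡⟨ sym (split (Out? ρ′)) ⟩
  Out ρ′ G                ∎
  where
  open ≡-Reasoning
  ρ′ = reverseFace F ρ
  G = GEdges fs
  S = faceEdges F
  inS? = λ e → e ∈E? S
  N = filter (λ e → ¬? (inS? e)) G
  uS = faceEdges-unique F
  uN = UniqueP.filter⁺ (λ e → ¬? (inS? e)) (GEdges-unique fs)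
  In? : ∀ τ → Decidable (λ e → dstσ τ e ≡ v)
  In? τ e = dstσ τ e ≟V v
  Out? : ∀ τ → Decidable (λ e → srcσ τ e ≡ v)
  Out? τ e = srcσ τ e ≟V v
  In Out : Ori → List Edge → ℕ
  In τ = count (In? τ)
  Out τ = count (Out? τ)
  flipped : ∀ {x} → x ∈ S → ρ′ x ≡ not (ρ x)
  flipped = reverseFace-∈ F ρ
  unchanged : ∀ {x} → x ∈ N → ρ′ x ≡ ρ x
  unchanged m = reverseFace-∉ F ρ (proj₂ (∈-filter⁻ (λ e → ¬? (inS? e)) {xs = G} m))
  split : ∀ {P : Pred Edge 0ℓ} (P? : Decidable P) → count P? G ≡ count P? S + count P? N
  split P? = trans (count-split P? inS? G) (cong (_+ count P? N)
    (count-cong P? P? (UniqueP.filter⁺ inS? (GEdges-unique fs)) uS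
      (λ (m , p) → proj₂ (∈-filter⁻ inS? {xs = G} m) , p) (λ (m , p) → ∈-filter⁺ inS? (∈GEdges mF m) m , p)))
  balanced : Out ρ S ≡ In ρ S
  balanced = directed-balanced ρ F v dF
  N-balanced : In ρ N ≡ Out ρ N
  N-balanced = ℕP.+-cancelˡ-≡ (In ρ S) _ _ (begin
    In ρ S + In ρ N    ≡⟨ sym (split (In? ρ)) ⟩
    In ρ G             ≡⟨ eo v ⟩
    Out ρ G            ≡⟨ split (Out? ρ) ⟩
    Out ρ S + Out ρ N  ≡⟨ cong (_+ Out ρ N) balanced ⟩
    In ρ S + Out ρ N   ∎)

IsEO-Agree : ∀ fs {ρ ρ′} → Agree fs ρ ρ′ → IsEO fs ρ′ → IsEO fs ρ
IsEO-Agree fs {ρ} {ρ′} ag eo v =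
  trans (count-≐ (λ e → dstσ ρ e ≟V v) (λ e → dstσ ρ′ e ≟V v) u (λ m → trans (sym (dst-same ρ′ ρ _ (ag _ m))))
                                                                   (λ m → trans (dst-same ρ′ ρ _ (ag _ m))))
   (trans (eo v)
    (count-≐ (λ e → srcσ ρ′ e ≟V v) (λ e → srcσ ρ e ≟V v) u (λ m → trans (sym (src-same ρ ρ′ _ (sym (ag _ m)))))
                                                              (λ m → trans (src-same ρ ρ′ _ (sym (ag _ m))))))
  where
  u = GEdges-unique fs

FlipPath-IsEO : ∀ {fs σ τ n} → FlipPath fs σ τ n → IsEO fs τ → IsEO fs σ
FlipPath-IsEO {fs} (done ag) eo = IsEO-Agree fs ag eo
FlipPath-IsEO {fs} {σ} (flip F m d rest) eo =
  IsEO-Agree fs (λ e _ → sym (reverseFace-involutive F σ e))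
    (IsEO-reverseFace fs (reverseFace F σ) F (FlipPath-IsEO rest eo) m (trans (isDirected-reverseFace F σ) d))

-- Reversing a tower

-- the third direction (for equal arguments, some other direction)
third : Dir → Dir → Dir
third d0 d1 = d2
third d1 d0 = d2
third d0 d2 = d1
third d2 d0 = d1
third d1 d2 = d0
third d2 d1 = d0
third d0 d0 = d1
third d1 d1 = d2
third d2 d2 = d0

third≢₁ : ∀ a b → third a b ≢ a
third≢₁ d0 d0 ()
third≢₁ d0 d1 ()
third≢₁ d0 d2 ()
third≢₁ d1 d0 ()
third≢₁ d1 d1 ()
third≢₁ d1 d2 ()
third≢₁ d2 d0 ()
third≢₁ d2 d1 ()
third≢₁ d2 d2 ()

third≢₂ : ∀ a b → a ≢ b → third a b ≢ b
third≢₂ d0 d0 ne = ⊥-elim (ne refl)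
third≢₂ d1 d1 ne = ⊥-elim (ne refl)
third≢₂ d2 d2 ne = ⊥-elim (ne refl)
third≢₂ d0 d1 ne ()
third≢₂ d0 d2 ne ()
third≢₂ d1 d0 ne ()
third≢₂ d1 d2 ne ()
third≢₂ d2 d0 ne ()
third≢₂ d2 d1 ne ()

crossing-opposite : ∀ γ a b → a ≢ γ → b ≢ γ → a ≢ b → crossing γ b ≡ ℤ.- crossing γ a
crossing-opposite d0 d0 d0 p q r = ⊥-elim (p refl)
crossing-opposite d0 d0 d1 p q r = ⊥-elim (p refl)
crossing-opposite d0 d0 d2 p q r = ⊥-elim (p refl)
crossing-opposite d0 d1 d0 p q r = ⊥-elim (q refl)
crossing-opposite d0 d1 d1 p q r = ⊥-elim (r refl)
crossing-opposite d0 d1 d2 p q r = refl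
crossing-opposite d0 d2 d0 p q r = ⊥-elim (q refl)
crossing-opposite d0 d2 d1 p q r = refl
crossing-opposite d0 d2 d2 p q r = ⊥-elim (r refl)
crossing-opposite d1 d0 d0 p q r = ⊥-elim (r refl)
crossing-opposite d1 d0 d1 p q r = ⊥-elim (q refl)
crossing-opposite d1 d0 d2 p q r = refl
crossing-opposite d1 d1 d0 p q r = ⊥-elim (p refl)
crossing-opposite d1 d1 d1 p q r = ⊥-elim (p refl)
crossing-opposite d1 d1 d2 p q r = ⊥-elim (p refl)
crossing-opposite d1 d2 d0 p q r = refl
crossing-opposite d1 d2 d1 p q r = ⊥-elim (q refl)
crossing-opposite d1 d2 d2 p q r = ⊥-elim (r refl)
crossing-opposite d2 d0 d0 p q r = ⊥-elim (r refl)
crossing-opposite d2 d0 d1 p q r = refl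
crossing-opposite d2 d0 d2 p q r = ⊥-elim (q refl)
crossing-opposite d2 d1 d0 p q r = refl
crossing-opposite d2 d1 d1 p q r = ⊥-elim (r refl)
crossing-opposite d2 d1 d2 p q r = ⊥-elim (q refl)
crossing-opposite d2 d2 d0 p q r = ⊥-elim (p refl)
crossing-opposite d2 d2 d1 p q r = ⊥-elim (p refl)
crossing-opposite d2 d2 d2 p q r = ⊥-elim (p refl)

signed-flip : ∀ u x → signed (not u) (ℤ.- x) ≡ signed u x
signed-flip true x = ℤP.neg-involutive x
signed-flip false x = refl

data Monotone (γ : Dir) (c : ℤ) : List Face → Set where
  single : ∀ {F} → Monotone γ c (F ∷ [])
  rise : ∀ {F G T} → level γ G ≡ level γ F ℤ.+ c → Monotone γ c (G ∷ T) → Monotone γ c (F ∷ G ∷ T)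

Separated : List Face → Set
Separated (F ∷ G ∷ T) = All (λ H → ∀ {e} → e ∈ faceEdges F → e ∉ faceEdges H) T × Separated (G ∷ T)
Separated _ = ⊤

adjacent-levels : ∀ γ F H {e} → e ∈ faceEdges F → e ∈ faceEdges H →
                  ∃ λ c → level γ H ≡ level γ F ℤ.+ c × (c ≡ + 0 ⊎ UnitStep c)
adjacent-levels γ F H {e} mF mH with shared-edge F H mF mH
... | inj₁ refl = + 0 , sym (ℤP.+-identityʳ _) , inj₁ refl
... | inj₂ refl with proj₂ e ≟D γ
...   | yes refl = + 0 , trans (level-across γ F mF) (cong (λ z → level γ F ℤ.+ z) no-change) , inj₁ refl
  where
  no-change = trans (cong (signed (isUp F)) (crossing-self γ)) (signed-zero (isUp F))
...   | no α≢γ = _ , level-across γ F mF , inj₂ (signed-unit (isUp F) (crossing-unit γ (proj₂ e) α≢γ))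

far-above : ∀ γ F H n → level γ H ≡ level γ F ℤ.+ + suc (suc n) → ∀ {e} → e ∈ faceEdges F → e ∉ faceEdges H
far-above γ F H n h mF mH with adjacent-levels γ F H mF mH
... | c , l , c∈ with +-cancelˡ (level γ F) (trans (sym h) l) | c∈
...   | refl | inj₁ ()
...   | refl | inj₂ (inj₁ ())
...   | refl | inj₂ (inj₂ ())

far-below : ∀ γ F H n → level γ H ≡ level γ F ℤ.+ -[1+ suc n ] → ∀ {e} → e ∈ faceEdges F → e ∉ faceEdges H
far-below γ F H n h mF mH with adjacent-levels γ F H mF mH
... | c , l , c∈ with +-cancelˡ (level γ F) (trans (sym h) l) | c∈
...   | refl | inj₁ ()
...   | refl | inj₂ (inj₁ ())
...   | refl | inj₂ (inj₂ ())

ascending : ∀ {γ F T} → Monotone γ (+ 1) (F ∷ T) → ∀ {H} → H ∈ T → ∃ λ n → level γ H ≡ level γ F ℤ.+ + suc n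
ascending (rise e _) (here refl) = 0 , e
ascending {γ} {F} (rise e rest) (there m) with ascending rest m
... | n , e′ = suc n , trans e′ (trans (cong (ℤ._+ + suc n) e) (ℤP.+-assoc (level γ F) (+ 1) (+ suc n)))

descending : ∀ {γ F T} → Monotone γ -[1+ 0 ] (F ∷ T) → ∀ {H} → H ∈ T → ∃ λ n → level γ H ≡ level γ F ℤ.+ -[1+ n ]
descending (rise e _) (here refl) = 0 , e
descending {γ} {F} (rise e rest) (there m) with descending rest m
... | n , e′ = suc n , trans e′ (trans (cong (ℤ._+ -[1+ n ]) e) (ℤP.+-assoc (level γ F) -[1+ 0 ] -[1+ n ]))

monotone⇒separated : ∀ {γ c T} → UnitStep c → Monotone γ c T → Separated T
monotone⇒separated _ single = tt
monotone⇒separated {γ} c±1 (rise {F} {G} {T} e rest) = All.tabulate (far c±1) , monotone⇒separated c±1 rest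
  where
  far : UnitStep _ → ∀ {H} → H ∈ T → ∀ {x} → x ∈ faceEdges F → x ∉ faceEdges H
  far (inj₁ refl) m with ascending rest m
  ... | n , h = far-above γ F _ n (trans h (trans (cong (ℤ._+ + suc n) e) (ℤP.+-assoc (level γ F) (+ 1) (+ suc n))))
  far (inj₂ refl) m with descending rest m
  ... | n , h = far-below γ F _ n (trans h (trans (cong (ℤ._+ -[1+ n ]) e) (ℤP.+-assoc (level γ F) -[1+ 0 ] -[1+ n ])))

module _ {fs : List Face} {σ : Ori} (eo : IsEO fs σ) where

  private
    blk : Face → Edge
    blk = blocking σ

  Tower-head : ∀ {F T} → Tower fs σ (F ∷ T) → F ∈ fs
  Tower-head (top m _) = m
  Tower-head (climb m _ _ _) = m

  tower-no-bounce : ∀ {F G T} → Tower fs σ (F ∷ G ∷ T) → isDirected σ G ≡ false → blk G ≢ blk F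
  tower-no-bounce {F} {G} tw@(climb mF nF eF rest) nG eq = two-cycle-blocks-tower nF nG eF G→F tw
    where
    G→F : nextFace σ G ≡ F
    G→F = trans (cong (across G) eq) (trans (cong (λ X → across X (blk F)) (sym eF)) (across-involutive F (blocking∈ σ F)))

  blocking∈nextFace : ∀ {F G T} → Tower fs σ (F ∷ G ∷ T) → blk F ∈ faceEdges G
  blocking∈nextFace {F} (climb _ _ eF _) = subst (λ X → blk F ∈ faceEdges X) eF (∈-across F (blocking∈ σ F))

  tower-shared-edge : ∀ {F G T} → Tower fs σ (F ∷ G ∷ T) → ∀ {e} → e ∈ faceEdges F → e ∈ faceEdges G → e ≡ blk F
  tower-shared-edge {F} (climb _ _ eF _) mF mG with shared-edge F _ mF mG
  ... | inj₁ G≡F = ⊥-elim (across-≢ F (blocking∈ σ F) (trans eF G≡F))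
  ... | inj₂ G≡ = across-injective F mF (blocking∈ σ F) (trans (sym G≡) (sym eF))

  isUp-nextFace : ∀ {F G T} → Tower fs σ (F ∷ G ∷ T) → isUp G ≡ not (isUp F)
  isUp-nextFace {F} (climb _ _ eF _) = trans (cong isUp (sym eF)) (isUp-across F (blocking∈ σ F))

  tower-turns : ∀ {F G T} → Tower fs σ (F ∷ G ∷ T) → isDirected σ G ≡ false → proj₂ (blk G) ≢ proj₂ (blk F)
  tower-turns {F} {G} tw nG dd = tower-no-bounce tw nG (sameDir⇒≡ G (blocking∈ σ G) (blocking∈nextFace tw) dd)

  tower-alternates : ∀ {F G H T} → Tower fs σ (F ∷ G ∷ H ∷ T) → isDirected σ G ≡ false → isDirected σ H ≡ false →
                     proj₂ (blk H) ≡ proj₂ (blk F)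
  tower-alternates tw@(climb mF nF eF rest@(climb mG _ eG rest₂)) nG nH
    with blocked-path-straight fs σ eo _ _ _ _ _ _ mF mG (Tower-head rest₂) nF nG nH refl refl refl eF eG
  ... | inj₁ d = d
  ... | inj₂ (inj₁ e) = ⊥-elim (tower-no-bounce tw nG e)
  ... | inj₂ (inj₂ e) = ⊥-elim (tower-no-bounce rest nH e)

  level-nextFace : ∀ γ {F G T} → Tower fs σ (F ∷ G ∷ T) →
                   level γ G ≡ level γ F ℤ.+ signed (isUp F) (crossing γ (proj₂ (blk F)))
  level-nextFace γ {F} (climb _ _ eF _) = trans (cong (level γ) (sym eF)) (level-across γ F (blocking∈ σ F))

  monotone : ∀ {F T} → Tower fs σ (F ∷ T) → ∀ γ c →
             (isDirected σ F ≡ false → proj₂ (blk F) ≢ γ × signed (isUp F) (crossing γ (proj₂ (blk F))) ≡ c) →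
             (∀ {G T′} → T ≡ G ∷ T′ → isDirected σ G ≡ false → proj₂ (blk G) ≢ γ) →
             Monotone γ c (F ∷ T)
  monotone (top _ _) γ c _ _ = single
  monotone {F} tw@(climb {G = G} {T = T′} _ nF _ rest) γ c hF hT =
    rise (trans (level-nextFace γ tw) (cong (λ z → level γ F ℤ.+ z) (proj₂ (hF nF)))) (monotone rest γ c hG hT′)
    where
    hG : isDirected σ G ≡ false → proj₂ (blk G) ≢ γ × signed (isUp G) (crossing γ (proj₂ (blk G))) ≡ c
    hG nG = hT refl nG ,
      trans (cong₂ signed (isUp-nextFace tw)
                          (crossing-opposite γ (proj₂ (blk F)) (proj₂ (blk G)) (proj₁ (hF nF)) (hT refl nG)
                                             (λ e → tower-turns tw nG (sym e))))
            (trans (signed-flip (isUp F) _) (proj₂ (hF nF)))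
    hT′ : ∀ {H T″} → T′ ≡ H ∷ T″ → isDirected σ H ≡ false → proj₂ (blk H) ≢ γ
    hT′ refl nH e = proj₁ (hF nF) (trans (sym (tower-alternates tw (nG rest) nH)) e)
      where
      nG : ∀ {T} → Tower fs σ (G ∷ _ ∷ T) → isDirected σ G ≡ false
      nG (climb _ n _ _) = n

  tower-separated : ∀ {T} → Tower fs σ T → Separated T
  tower-separated (top _ _) = tt
  tower-separated {F ∷ G ∷ T′} tw@(climb _ nF _ _) with isDirected σ G in dG
  ... | true = monotone⇒separated (signed-unit (isUp F) (crossing-unit γ α (λ e → third≢₁ α α (sym e))))
                 (monotone tw γ _ (λ _ → (λ e → third≢₁ α α (sym e)) , refl)
                                  (λ { refl nG → ⊥-elim (true≢false (trans (sym dG) nG)) }))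
    where
    α = proj₂ (blk F)
    γ = third α α
  ... | false = monotone⇒separated (signed-unit (isUp F) (crossing-unit γ α (λ e → third≢₁ α β (sym e))))
                 (monotone tw γ _ (λ _ → (λ e → third≢₁ α β (sym e)) , refl)
                                  (λ { refl nG e → third≢₂ α β (λ e′ → tower-turns tw dG (sym e′)) (sym e) }))
    where
    α = proj₂ (blk F)
    β = proj₂ (blk G)
    γ = third α β

parity : List Face → Edge → Bool
parity T e = foldr (λ F b → b xor memB _≟E_ e (faceEdges F)) false T

parity-false : ∀ T {e} → All (λ H → e ∉ faceEdges H) T → parity T e ≡ false
parity-false [] _ = refl
parity-false (H ∷ T) {e} (e∉H ∷ rest) rewrite parity-false T rest | memB-∉ {e} {faceEdges H} e∉H = refl

xor-cancel-middle : ∀ s r m → (s xor (r xor m)) xor (false xor m) ≡ s xor r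
xor-cancel-middle s r m = trans (xor-assoc s (r xor m) m) (cong (s xor_) (xor-cancelʳ r m))

ccw-unchanged : ∀ ρ ρ′ e fl → ρ′ e ≡ ρ e → ccw ρ′ (e , fl) ≡ ccw ρ (e , fl)
ccw-unchanged ρ ρ′ e fl h = cong (λ b → not (b xor fl)) h

-- Reversing the top face, then the one below it, and so on: after reversing the faces above it,
-- each face of a tower is directed, since its blocking side has been reversed twice and its other sides once.
tower-flipPath : ∀ {fs σ T} → IsEO fs σ → Tower fs σ T → FlipPath fs (reverseFaces T σ) σ (length T)
tower-flipPath {fs} {σ} eo tw = go tw (tower-separated eo tw)
  where
  go : ∀ {T} → Tower fs σ T → Separated T → FlipPath fs (reverseFaces T σ) σ (length T)
  go (top {F} mF dF) _ = FlipPath-single F mF dF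
  go tw@(climb {F} {G} {T′} mF nF _ rest) (far , sep) =
    flip F mF (constant-ccw⇒directed σ′ F (ccwAt σ F b) ccw′)
      (FlipPath-respˡ (λ e _ → xor-cancel-middle (σ e) (parity (G ∷ T′) e) (memB _≟E_ e (faceEdges F))) (go rest sep))
    where
    σ′ = reverseFaces (F ∷ G ∷ T′) σ
    b = blockingPos σ F
    above : ∀ p → parity T′ (edgeAt F p) ≡ false
    above p = parity-false T′ (All.map (λ e∉ → e∉ (edgeAt∈ F p)) far)
    unflipped : σ′ (edgeAt F b) ≡ σ (edgeAt F b)
    unflipped rewrite above b
      | memB-∈ {edgeAt F b} {faceEdges G} (subst (_∈ faceEdges G) (blocking≡edgeAt σ F) (blocking∈nextFace eo tw))
      | memB-∈ {edgeAt F b} {faceEdges F} (edgeAt∈ F b) = xor-identityʳ _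
    flipped : ∀ p → p ≢ b → σ′ (edgeAt F p) ≡ not (σ (edgeAt F p))
    flipped p p≢b rewrite above p
      | memB-∉ {edgeAt F p} {faceEdges G}
          (λ mG → p≢b (edgeAt-injective F p b (trans (tower-shared-edge eo tw (edgeAt∈ F p) mG) (blocking≡edgeAt σ F))))
      | memB-∈ {edgeAt F p} {faceEdges F} (edgeAt∈ F p) = BoolP.xor-comm _ true
    ccw′ : ∀ p → ccwAt σ′ F p ≡ ccwAt σ F b
    ccw′ p with p ≟P b
    ... | yes refl = ccw-unchanged σ σ′ (edgeAt F p) _ unflipped
    ... | no p≢b = trans (ccw-flipped σ σ′ (edgeAt F p) _ (flipped p p≢b))
                         (trans (cong not (blocking-odd σ F nF p p≢b)) (not-involutive _))

moveLength : List Face → Ori → Face → ℕ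
moveLength fs σ F with isDirected σ F | tower fs σ F
... | true | _ = 1
... | false | just T = length T
... | false | nothing = 0

data MoveView (fs : List Face) (σ : Ori) (F : Face) : Set where
  directed : isDirected σ F ≡ true → MoveView fs σ F
  tower-move : ∀ T → isDirected σ F ≡ false → tower fs σ F ≡ just T → MoveView fs σ F
  stuck : isDirected σ F ≡ false → tower fs σ F ≡ nothing → MoveView fs σ F

moveView : ∀ fs σ F → MoveView fs σ F
moveView fs σ F = view (isDirected σ F) refl (tower fs σ F) refl
  where
  view : ∀ b → isDirected σ F ≡ b → ∀ m → tower fs σ F ≡ m → MoveView fs σ F
  view true d _ _ = directed d
  view false d (just T) t = tower-move T d t
  view false d nothing t = stuck d t

move-flipPath : ∀ {fs σ F} → IsEO fs σ → F ∈ fs → FlipPath fs (proj₂ (move fs σ F)) σ (moveLength fs σ F)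
move-flipPath {fs} {σ} {F} eo mF with moveView fs σ F
... | directed d rewrite d = FlipPath-single F mF d
... | stuck n t rewrite n | t = done (λ _ _ → refl)
... | tower-move T n t with tower-sound fs σ F t
...   | tw , _ rewrite n | t = tower-flipPath eo tw

ι : ℕ → ℚ
ι n = (+ n) ℚ./ 1

⅓ : ℚ
⅓ = inv 3

ι≃ : ∀ n → toℚᵘ (ι n) ℚᵘ.≃ mkℚᵘ (+ n) 0
ι≃ n = ℚP.toℚᵘ-fromℚᵘ (mkℚᵘ (+ n) 0)

inv≃ : ∀ n → toℚᵘ (inv (suc n)) ℚᵘ.≃ mkℚᵘ (+ 1) n
inv≃ n = ℚP.toℚᵘ-fromℚᵘ (mkℚᵘ (+ 1) n)

ι-mono : ∀ {a b} → a ℕ.≤ b → ι a ≤ ι b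
ι-mono {a} {b} h = ℚP.toℚᵘ-cancel-≤ (ℚᵘP.≤-respˡ-≃ (ℚᵘP.≃-sym (ι≃ a)) (ℚᵘP.≤-respʳ-≃ (ℚᵘP.≃-sym (ι≃ b))
  (*≤* (subst₂ ℤ._≤_ (sym (ℤP.*-identityʳ (+ a))) (sym (ℤP.*-identityʳ (+ b))) (ℤ.+≤+ h)))))

ι-+ : ∀ a b → ι (a + b) ≡ ι a ℚ.+ ι b
ι-+ a b = ℚP.toℚᵘ-injective (ℚᵘP.≃-trans (ι≃ (a + b)) (ℚᵘP.≃-trans lem (ℚᵘP.≃-sym
            (ℚᵘP.≃-trans (ℚP.toℚᵘ-homo-+ (ι a) (ι b)) (ℚᵘP.+-cong (ι≃ a) (ι≃ b))))))
  where
  lem : mkℚᵘ (+ (a + b)) 0 ℚᵘ.≃ (mkℚᵘ (+ a) 0 ℚᵘ.+ mkℚᵘ (+ b) 0)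
  lem = *≡* (trans (cong (ℤ._* + 1) (ℤP.pos-+ a b)) (l (+ a) (+ b)))
    where
    l : ∀ x y → (x ℤ.+ y) ℤ.* + 1 ≡ (x ℤ.* + 1 ℤ.+ y ℤ.* + 1) ℤ.* + 1
    l = solve-∀

inv[3n]*n≡⅓ : ∀ n → inv (3 * suc n) ℚ.* ι (suc n) ≡ ⅓
inv[3n]*n≡⅓ n = ℚP.toℚᵘ-injective (ℚᵘP.≃-trans (ℚP.toℚᵘ-homo-* (inv (3 * suc n)) (ι (suc n)))
                  (ℚᵘP.≃-trans (ℚᵘP.*-cong (inv≃ (n + 2 * suc n)) (ι≃ (suc n)))
                    (ℚᵘP.≃-trans lem (ℚᵘP.≃-sym (inv≃ 2)))))
  where
  lem : (mkℚᵘ (+ 1) (n + 2 * suc n) ℚᵘ.* mkℚᵘ (+ suc n) 0) ℚᵘ.≃ mkℚᵘ (+ 1) 2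
  lem = *≡* (cong +_ (e n))
    where
    e : ∀ n → suc (suc (suc ((n + 0 * suc n) * 3))) ≡ suc ((n + 2 * suc n) * 1 + 0 * suc ((n + 2 * suc n) * 1))
    e = ℕ-solve-∀

inv[2n]*⅔≡inv[3n] : ∀ n → inv (2 * n) ℚ.* (⅓ ℚ.+ ⅓) ≡ inv (3 * n)
inv[2n]*⅔≡inv[3n] zero = ℚP.*-zeroˡ (⅓ ℚ.+ ⅓)
inv[2n]*⅔≡inv[3n] (suc n) = ℚP.toℚᵘ-injective (ℚᵘP.≃-trans (ℚP.toℚᵘ-homo-* (inv (2 * suc n)) (⅓ ℚ.+ ⅓))
                        (ℚᵘP.≃-trans (ℚᵘP.*-cong (inv≃ (n + 1 * suc n))
                                       (ℚᵘP.≃-trans (ℚP.toℚᵘ-homo-+ ⅓ ⅓) (ℚᵘP.+-cong (inv≃ 2) (inv≃ 2))))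
                          (ℚᵘP.≃-trans lem (ℚᵘP.≃-sym (inv≃ (n + 2 * suc n))))))
  where
  lem : (mkℚᵘ (+ 1) (n + 1 * suc n) ℚᵘ.* (mkℚᵘ (+ 1) 2 ℚᵘ.+ mkℚᵘ (+ 1) 2)) ℚᵘ.≃ mkℚᵘ (+ 1) (n + 2 * suc n)
  lem = *≡* (cong +_ (e n))
    where
    e : ∀ n → suc ((n + 2 * suc n) + 5 * suc (n + 2 * suc n)) ≡
              suc (suc (suc (suc (suc (suc (suc (suc (suc ((n + 1 * suc n) * 9 +
                0 * suc (suc (suc (suc (suc (suc (suc (suc (suc ((n + 1 * suc n) * 9))))))))))))))))))
    e = ℕ-solve-∀

inv-nonNeg : ∀ n → 0ℚ ≤ inv n
inv-nonNeg zero = ℚP.≤-refl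
inv-nonNeg (suc n) = ℚP.toℚᵘ-cancel-≤ (ℚᵘP.≤-respʳ-≃ (ℚᵘP.≃-sym (inv≃ n)) (*≤* (ℤ.+≤+ z≤n)))

≤⇒0≤- : ∀ {m p} → m ≤ p → 0ℚ ≤ p ℚ.- m
≤⇒0≤- {m} {p} h = subst (_≤ p ℚ.- m) (ℚP.+-inverseʳ m) (ℚP.+-monoˡ-≤ (ℚ.- m) h)

+-nonNeg : ∀ {a b} → 0ℚ ≤ a → 0ℚ ≤ b → 0ℚ ≤ a ℚ.+ b
+-nonNeg {a} {b} ha hb = subst (_≤ a ℚ.+ b) (ℚP.+-identityˡ 0ℚ) (ℚP.+-mono-≤ ha hb)

-- Both chains move with probability m, chain i alone with probability pᵢ - m.
coupled-bound : ∀ m p₁ p₂ a b c H₁ H₂ → 0ℚ ≤ m → m ≤ p₁ → m ≤ p₂ →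
                a ≤ H₁ ℚ.+ H₂ → b ≤ H₁ → c ≤ H₂ →
                m ℚ.* a ℚ.+ (p₁ ℚ.- m) ℚ.* b ℚ.+ (p₂ ℚ.- m) ℚ.* c ≤ p₁ ℚ.* H₁ ℚ.+ p₂ ℚ.* H₂
coupled-bound m p₁ p₂ a b c H₁ H₂ 0≤m m≤p₁ m≤p₂ a≤ b≤ c≤ =
  subst (m ℚ.* a ℚ.+ (p₁ ℚ.- m) ℚ.* b ℚ.+ (p₂ ℚ.- m) ℚ.* c ≤_) (regroup m p₁ p₂ H₁ H₂)
    (ℚP.+-mono-≤ (ℚP.+-mono-≤ (ℚP.*-monoˡ-≤-nonNeg m {{ℚ.nonNegative 0≤m}} a≤)
                              (ℚP.*-monoˡ-≤-nonNeg (p₁ ℚ.- m) {{ℚ.nonNegative (≤⇒0≤- m≤p₁)}} b≤))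
                 (ℚP.*-monoˡ-≤-nonNeg (p₂ ℚ.- m) {{ℚ.nonNegative (≤⇒0≤- m≤p₂)}} c≤))
  where
  open +-*-Solver
  regroup : ∀ m p₁ p₂ H₁ H₂ → m ℚ.* (H₁ ℚ.+ H₂) ℚ.+ (p₁ ℚ.- m) ℚ.* H₁ ℚ.+ (p₂ ℚ.- m) ℚ.* H₂ ≡ p₁ ℚ.* H₁ ℚ.+ p₂ ℚ.* H₂
  regroup = solve 5 (λ m p₁ p₂ H₁ H₂ → m :* (H₁ :+ H₂) :+ (p₁ :- m) :* H₁ :+ (p₂ :- m) :* H₂ := p₁ :* H₁ :+ p₂ :* H₂) refl

ι-difference : ∀ x y z → x ℕ.≤ z + y → ι x ℚ.- ι y ≤ ι z
ι-difference x y z h = subst (ι x ℚ.- ι y ≤_) (cancel (ι z) (ι y))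
  (ℚP.+-monoˡ-≤ (ℚ.- ι y) (subst (ι x ≤_) (ι-+ z y) (ι-mono h)))
  where
  open +-*-Solver
  cancel : ∀ z y → (z ℚ.+ y) ℚ.- y ≡ z
  cancel = solve 2 (λ z y → (z :+ y) :- y := z) refl

interchange : ∀ a b c d → (a ℚ.+ b) ℚ.+ (c ℚ.+ d) ≡ (b ℚ.+ c) ℚ.+ (a ℚ.+ d)
interchange = solve 4 (λ a b c d → (a :+ b) :+ (c :+ d) := (b :+ c) :+ (a :+ d)) refl
  where open +-*-Solver

sumℚ : List ℚ → ℚ
sumℚ = foldr ℚ._+_ 0ℚ

module _ {A : Set} where

  sumℚ-nonNeg : ∀ (f : A → ℚ) xs → (∀ x → 0ℚ ≤ f x) → 0ℚ ≤ sumℚ (map f xs)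
  sumℚ-nonNeg f [] _ = ℚP.≤-refl
  sumℚ-nonNeg f (x ∷ xs) h = +-nonNeg (h x) (sumℚ-nonNeg f xs h)

  sumℚ-++ : ∀ (f : A → ℚ) xs ys → sumℚ (map f (xs ++ ys)) ≡ sumℚ (map f xs) ℚ.+ sumℚ (map f ys)
  sumℚ-++ f [] ys = sym (ℚP.+-identityˡ _)
  sumℚ-++ f (x ∷ xs) ys = trans (cong (f x ℚ.+_) (sumℚ-++ f xs ys)) (sym (ℚP.+-assoc (f x) _ _))

  sumℚ-scale : ∀ c (f : A → ℚ) xs → sumℚ (map (λ x → c ℚ.* f x) xs) ≡ c ℚ.* sumℚ (map f xs)
  sumℚ-scale c f [] = sym (ℚP.*-zeroʳ c)
  sumℚ-scale c f (x ∷ xs) = trans (cong (c ℚ.* f x ℚ.+_) (sumℚ-scale c f xs)) (sym (ℚP.*-distribˡ-+ c (f x) _))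

  sumℚ-cong : ∀ {f g : A → ℚ} → (∀ x → f x ≡ g x) → ∀ xs → sumℚ (map f xs) ≡ sumℚ (map g xs)
  sumℚ-cong f≗g xs = cong sumℚ (map-cong f≗g xs)

  sumℚ-∷-middle : ∀ (f : A → ℚ) x ys zs → sumℚ (map f (ys ++ x ∷ zs)) ≡ f x ℚ.+ sumℚ (map f (ys ++ zs))
  sumℚ-∷-middle f x [] zs = refl
  sumℚ-∷-middle f x (y ∷ ys) zs = trans (cong (f y ℚ.+_) (sumℚ-∷-middle f x ys zs)) (swap (f y) (f x) _)
    where
    open +-*-Solver
    swap : ∀ a b c → a ℚ.+ (b ℚ.+ c) ≡ b ℚ.+ (a ℚ.+ c)
    swap = solve 3 (λ a b c → a :+ (b :+ c) := b :+ (a :+ c)) refl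

  sumℚ-⊆ : ∀ (g U : A → ℚ) {xs ys} → Unique xs → xs ⊆ ys → (∀ {x} → x ∈ xs → g x ≤ U x) →
           (∀ x → 0ℚ ≤ U x) → sumℚ (map g xs) ≤ sumℚ (map U ys)
  sumℚ-⊆ g U {[]} {ys} _ _ _ U≥0 = sumℚ-nonNeg U ys U≥0
  sumℚ-⊆ g U {x ∷ xs} (x∉xs ∷ u) sub g≤U U≥0 with ∈-∃++ (sub (here refl))
  ... | ys₁ , ys₂ , refl = subst (sumℚ (map g (x ∷ xs)) ≤_) (sym (sumℚ-∷-middle U x ys₁ ys₂))
        (ℚP.+-mono-≤ (g≤U (here refl)) (sumℚ-⊆ g U u sub′ (λ m → g≤U (there m)) U≥0))
    where
    sub′ : xs ⊆ ys₁ ++ ys₂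
    sub′ m = ∈-++-∷⁻ ys₁ ys₂ (sub (there m)) (λ eq → All.lookup x∉xs m (sym eq))

cost : List Face → Ori → Face → ℚ
cost fs σ F = proj₁ (move fs σ F) ℚ.* ι (moveLength fs σ F)

move-probability-nonNeg : ∀ fs σ F → 0ℚ ≤ proj₁ (move fs σ F)
move-probability-nonNeg fs σ F with moveView fs σ F
... | directed d rewrite d = ℚP.toℚᵘ-cancel-≤ (*≤* (ℤ.+≤+ z≤n))
... | tower-move T n t rewrite n | t = inv-nonNeg (3 * length T)
... | stuck n t rewrite n | t = ℚP.≤-refl

cost-nonNeg : ∀ fs σ F → 0ℚ ≤ cost fs σ F
cost-nonNeg fs σ F = subst (_≤ cost fs σ F) (ℚP.*-zeroˡ (ι (moveLength fs σ F)))
  (ℚP.*-monoʳ-≤-nonNeg (ι (moveLength fs σ F)) {{ℚ.nonNegative (ι-mono (z≤n {moveLength fs σ F}))}}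
                       (move-probability-nonNeg fs σ F))

cost-≤-⅓ : ∀ fs σ F → isDirected σ F ≡ false → cost fs σ F ≤ ⅓
cost-≤-⅓ fs σ F nF with moveView fs σ F
... | directed d = ⊥-elim (true≢false (trans (sym d) nF))
... | stuck n t rewrite n | t = subst (_≤ ⅓) (sym (ℚP.*-zeroʳ (ι 0))) (inv-nonNeg 3)
... | tower-move T n t with tower-sound fs σ F t
...   | _ , T′ , refl rewrite n | t = ℚP.≤-reflexive (inv[3n]*n≡⅓ (length T′))

cost-stuck : ∀ fs σ F → isDirected σ F ≡ false → tower fs σ F ≡ nothing → cost fs σ F ≡ 0ℚ
cost-stuck fs σ F n t rewrite n | t = ℚP.*-zeroˡ (ι 0)

module _ {fs : List Face} {d : Ori → Ori → ℕ} (dist : IsDistance fs d) where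

  distance-≤ : ∀ {σ τ n} → IsEO fs σ → IsEO fs τ → FlipPath fs σ τ n → d σ τ ℕ.≤ n
  distance-≤ eσ eτ p = proj₂ (dist _ _ eσ eτ) _ p

  geodesic : ∀ {σ τ} → IsEO fs σ → IsEO fs τ → FlipPath fs σ τ (d σ τ)
  geodesic eσ eτ = proj₁ (dist _ _ eσ eτ)

  -- After the coupled move, the distance changed by at most the number of reversals each chain made.
  pairContribution-≤-cost : ∀ {σ₁ σ₂ F} → IsEO fs σ₁ → IsEO fs σ₂ → F ∈ fs →
                            pairContribution fs d σ₁ σ₂ F ≤ cost fs σ₁ F ℚ.+ cost fs σ₂ F
  pairContribution-≤-cost {σ₁} {σ₂} {F} eo₁ eo₂ mF =
    coupled-bound (p₁ ⊓ p₂) p₁ p₂ (ι (d τ₁ τ₂) ℚ.- ι δ₀) (ι (d τ₁ σ₂) ℚ.- ι δ₀) (ι (d σ₁ τ₂) ℚ.- ι δ₀) (ι h₁) (ι h₂)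
      (ℚP.⊓-glb (move-probability-nonNeg fs σ₁ F) (move-probability-nonNeg fs σ₂ F))
      (ℚP.p⊓q≤p p₁ p₂) (ℚP.p⊓q≤q p₁ p₂)
      (subst (ι (d τ₁ τ₂) ℚ.- ι δ₀ ≤_) (ι-+ h₁ h₂) (ι-difference (d τ₁ τ₂) δ₀ (h₁ + h₂)
        (ℕP.≤-trans (distance-≤ eoτ₁ eoτ₂ (FlipPath-++ P₁ (FlipPath-++ (geodesic eo₁ eo₂) (FlipPath-sym P₂))))
                    (ℕP.≤-reflexive (regroup h₁ δ₀ h₂)))))
      (ι-difference (d τ₁ σ₂) δ₀ h₁ (distance-≤ eoτ₁ eo₂ (FlipPath-++ P₁ (geodesic eo₁ eo₂))))
      (ι-difference (d σ₁ τ₂) δ₀ h₂ (ℕP.≤-trans (distance-≤ eo₁ eoτ₂ (FlipPath-++ (geodesic eo₁ eo₂) (FlipPath-sym P₂)))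
                                       (ℕP.≤-reflexive (ℕP.+-comm δ₀ h₂))))
    where
    τ₁ = proj₂ (move fs σ₁ F)
    τ₂ = proj₂ (move fs σ₂ F)
    p₁ = proj₁ (move fs σ₁ F)
    p₂ = proj₁ (move fs σ₂ F)
    h₁ = moveLength fs σ₁ F
    h₂ = moveLength fs σ₂ F
    δ₀ = d σ₁ σ₂
    P₁ = move-flipPath eo₁ mF
    P₂ = move-flipPath eo₂ mF
    eoτ₁ = FlipPath-IsEO P₁ eo₁
    eoτ₂ = FlipPath-IsEO P₂ eo₂
    regroup : ∀ a b c → a + (b + c) ≡ (a + c) + b
    regroup = ℕ-solve-∀

Involved : List Face → Ori → Ori → Face → Face → Face → Set
Involved fs σ₁ σ₂ A B F = F ≢ A × (involves fs σ₁ F B ≡ true ⊎ involves fs σ₂ F B ≡ true)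

expectedδB-≤-costs : ∀ {fs d σ₁ σ₂ A B} → IsDistance fs d → Unique fs → IsEO fs σ₁ → IsEO fs σ₂ →
                     ∀ S → (∀ {F} → F ∈ fs → Involved fs σ₁ σ₂ A B F → F ∈ S) →
                     expectedδB fs d σ₁ σ₂ A B ≤ inv (2 * length fs) ℚ.* sumℚ (map (λ F → cost fs σ₁ F ℚ.+ cost fs σ₂ F) S)
expectedδB-≤-costs {fs} {d} {σ₁} {σ₂} {A} {B} dist ufs eo₁ eo₂ S covers =
  subst (expectedδB fs d σ₁ σ₂ A B ≤_) (sumℚ-scale c costs S)
    (sumℚ-⊆ (λ F → c ℚ.* pairContribution fs d σ₁ σ₂ F) (λ F → c ℚ.* costs F)
            (UniqueP.filter⁺ P? ufs) sub
            (λ m → ℚP.*-monoˡ-≤-nonNeg c {{ℚ.nonNegative c≥0}} (pairContribution-≤-cost dist eo₁ eo₂ (in-fs m)))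
            (λ F → subst (_≤ c ℚ.* costs F) (ℚP.*-zeroʳ c)
                         (ℚP.*-monoˡ-≤-nonNeg c {{ℚ.nonNegative c≥0}} (+-nonNeg (cost-nonNeg fs σ₁ F) (cost-nonNeg fs σ₂ F)))))
  where
  c = inv (2 * length fs)
  c≥0 = inv-nonNeg (2 * length fs)
  costs : Face → ℚ
  costs F = cost fs σ₁ F ℚ.+ cost fs σ₂ F
  P? = λ F → T? (not (isYes (F ≟F A)) ∧ (involves fs σ₁ F B ∨ involves fs σ₂ F B))
  in-fs : ∀ {F} → F ∈ filter P? fs → F ∈ fs
  in-fs m = proj₁ (∈-filter⁻ P? {xs = fs} m)
  involved : ∀ {F} → F ∈ filter P? fs → Involved fs σ₁ σ₂ A B F
  involved {F} m with F ≟F A | ∈-filter⁻ P? {xs = fs} m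
  ... | yes _ | _ , ()
  ... | no F≢A | _ , t = F≢A , ⊎-map T⇒≡ T⇒≡ (Equivalence.to BoolP.T-∨ t)
    where
    T⇒≡ : ∀ {b} → T b → b ≡ true
    T⇒≡ = Equivalence.to BoolP.T-≡
  sub : filter P? fs ⊆ S
  sub m = covers (in-fs m) (involved m)

BlockedAt : List Face → Ori → Face → Edge → Set
BlockedAt fs σ X x = X ∈ fs × isDirected σ X ≡ false × blocking σ X ≡ x

blockedAt? : ∀ fs σ X x → Dec (BlockedAt fs σ X x)
blockedAt? fs σ X x with X ∈F? fs | isDirected σ X BoolP.≟ false | blocking σ X ≟E x
... | yes m | yes n | yes b = yes (m , n , b)
... | no ¬m | _ | _ = no (λ h → ¬m (proj₁ h))
... | yes _ | no ¬n | _ = no (λ h → ¬n (proj₁ (proj₂ h)))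
... | yes _ | yes _ | no ¬b = no (λ h → ¬b (proj₂ (proj₂ h)))

involves⇒ : ∀ fs σ F B → involves fs σ F B ≡ true → F ≡ B ⊎ ∃ λ T → tower fs σ F ≡ just T × B ∈ T
involves⇒ fs σ F B h with F ≟F B | tower fs σ F
... | yes F≡B | _ = inj₁ F≡B
... | no _ | just T = inj₂ (T , refl , memB-true⇒∈ h)
involves⇒ fs σ F B () | no _ | nothing

-- A tower through B cannot enter B through e (A is directed), nor through its blocking side (a 2-cycle);
-- entering through x it must start right behind x, since a longer approach would be straight and
-- would then conflict with A being directed.
involving-faces : ∀ fs σ → IsEO fs σ → ∀ {A B e x} → A ∈ fs → B ∈ fs →
                  isDirected σ A ≡ true → isDirected σ B ≡ false → e ∈ faceEdges A → e ∈ faceEdges B →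
                  e ≢ blocking σ B → x ∈ faceEdges B → x ≢ e → x ≢ blocking σ B →
                  ∀ F → involves fs σ F B ≡ true → F ≡ B ⊎ (F ≡ across B x × BlockedAt fs σ (across B x) x)
involving-faces fs σ eo {A} {B} {e} {x} mA mB dA nB eA eB e≢b xB x≢e x≢b F inv with involves⇒ fs σ F B inv
... | inj₁ F≡B = inj₁ F≡B
... | inj₂ (T , t , B∈T) with F ≟F B
...   | yes F≡B = inj₁ F≡B
...   | no F≢B with tower-sound fs σ F t
...     | tw , _ , refl with tower-predecessor tw B∈T F≢B
...       | P , mP , nP , P→B , (_ , twB) , F≡P⊎Q = result F≡P⊎Q
  where
  b = blocking σ B
  gP = blocking σ P
  gP∈B : gP ∈ faceEdges B
  gP∈B = subst (λ X → gP ∈ faceEdges X) P→B (∈-across P (blocking∈ σ P))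
  B-across-gP : across B gP ≡ P
  B-across-gP = trans (cong (λ X → across X gP) (sym P→B)) (across-involutive P (blocking∈ σ P))
  A≡ : A ≡ across B e
  A≡ with shared-edge B A eB eA
  ... | inj₁ A≡B = ⊥-elim (true≢false (trans (sym dA) (trans (cong (isDirected σ) A≡B) nB)))
  ... | inj₂ A≡ = A≡
  P≡X : P ≡ across B x
  P≡X with the-other-side B eB (blocking∈ σ B) xB gP∈B e≢b x≢e x≢b
  ... | inj₁ gP≡e = ⊥-elim (true≢false (trans (sym dA)
                      (trans (cong (isDirected σ) (trans A≡ (trans (cong (across B) (sym gP≡e)) B-across-gP))) nP)))
  ... | inj₂ (inj₁ gP≡b) = ⊥-elim (two-cycle-blocks-tower nB nP (trans (cong (across B) (sym gP≡b)) B-across-gP) P→B twB)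
  ... | inj₂ (inj₂ gP≡x) = trans (sym B-across-gP) (cong (across B) gP≡x)
  X = across B x
  gP≡x : gP ≡ x
  gP≡x = across-injective B gP∈B xB (trans B-across-gP P≡X)
  mX : X ∈ fs
  mX = subst (_∈ fs) P≡X mP
  nX : isDirected σ X ≡ false
  nX = trans (cong (isDirected σ) (sym P≡X)) nP
  bX : blocking σ X ≡ x
  bX = trans (cong (blocking σ) (sym P≡X)) gP≡x
  X→B : across X x ≡ B
  X→B = trans (cong₂ across (sym P≡X) (sym gP≡x)) P→B
  result : (F ≡ P ⊎ ∃ λ Q → Q ∈ fs × isDirected σ Q ≡ false × nextFace σ Q ≡ P) →
           F ≡ B ⊎ (F ≡ X × BlockedAt fs σ X x)
  result (inj₁ F≡P) = inj₂ (trans F≡P P≡X , mX , nX , bX)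
  result (inj₂ (Q , mQ , nQ , Q→P)) with blocked-path-straight fs σ eo Q X B (blocking σ Q) x b mQ mX mB nQ nX nB refl bX refl
                                           (trans Q→P P≡X) X→B
  ... | inj₂ (inj₂ b≡x) = ⊥-elim (x≢b (sym b≡x))
  ... | inj₂ (inj₁ x≡gQ) = ⊥-elim (two-cycle-blocks-tower nB nX B→X (trans (cong (across X) bX) X→B) twB)
    where
    Q≡B : Q ≡ B
    Q≡B = trans (sym (trans (cong (λ Y → across Y (blocking σ Q)) (sym (trans Q→P P≡X)))
                            (across-involutive Q (blocking∈ σ Q))))
                (trans (cong (across X) (sym x≡gQ)) X→B)
    B→X : nextFace σ B ≡ X
    B→X = trans (cong (nextFace σ) (sym Q≡B)) (trans Q→P P≡X)
  ... | inj₁ straight = ⊥-elim (no-straight-approach fs σ eo A B X Q e b x (blocking σ Q) mA mB mX mQ dA nB nX nQ eA eB refl e≢b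
                                 xB x≢e x≢b refl bX refl (trans Q→P P≡X) (sym straight))

only-middle : ∀ a → 0ℚ ℚ.+ ((a ℚ.+ 0ℚ) ℚ.+ 0ℚ) ≡ a
only-middle = solve 1 (λ a → con 0ℚ :+ ((a :+ con 0ℚ) :+ con 0ℚ) := a) refl
  where open +-*-Solver

optional : {P : Set} → Dec P → Face → List Face
optional (yes _) X = X ∷ []
optional (no _) X = []

∈-optional : ∀ {P : Set} (D : Dec P) {X} → P → X ∈ optional D X
∈-optional (yes _) _ = here refl
∈-optional (no ¬p) p = ⊥-elim (¬p p)

-- The hypotheses are symmetric in σ and σ′, and the module is used for both orders.
module Neighbours {fs : List Face} {σ σ′ : Ori} (eo : IsEO fs σ) (eo′ : IsEO fs σ′)
  {A B : Face} {e : Edge} (mA : A ∈ fs) (mB : B ∈ fs) (B≢A : B ≢ A) (eA : e ∈ faceEdges A) (eB : e ∈ faceEdges B)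
  (dA : isDirected σ A ≡ true) (nB : isDirected σ B ≡ false) (nB′ : isDirected σ′ B ≡ false)
  (on-A : ∀ y → y ∈ faceEdges A → σ′ y ≡ not (σ y))
  (off-A : ∀ y → y ∈ GEdges fs → y ∉ faceEdges A → σ′ y ≡ σ y) where

  A≡ : A ≡ across B e
  A≡ with shared-edge B A eB eA
  ... | inj₁ A≡B = ⊥-elim (B≢A (sym A≡B))
  ... | inj₂ A≡ = A≡

  only-e : ∀ {s} → s ∈ faceEdges B → s ∈ faceEdges A → s ≡ e
  only-e ms msA with shared-edge B A ms msA
  ... | inj₁ A≡B = ⊥-elim (B≢A (sym A≡B))
  ... | inj₂ A≡′ = across-injective B ms eB (trans (sym A≡′) A≡)

  pe : Pos
  pe = proj₁ (∈faceEdges⇒edgeAt B eB)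

  e≡ : e ≡ edgeAt B pe
  e≡ = proj₂ (∈faceEdges⇒edgeAt B eB)

  ccw-kept : ∀ p → p ≢ pe → ccwAt σ′ B p ≡ ccwAt σ B p
  ccw-kept p p≢pe = ccw-unchanged σ σ′ (edgeAt B p) _
    (off-A _ (∈GEdges mB (edgeAt∈ B p)) (λ m → p≢pe (edgeAt-injective B p pe (trans (only-e (edgeAt∈ B p) m) e≡))))

  ccw-reversed : ccwAt σ′ B pe ≡ not (ccwAt σ B pe)
  ccw-reversed = ccw-flipped σ σ′ (edgeAt B pe) _ (on-A _ (subst (_∈ faceEdges A) e≡ eA))

  module Forth = OneSideFlipped {σ} {σ′} ccw-kept ccw-reversed nB nB′
  module Back = OneSideFlipped {σ′} {σ} (λ p p≢pe → sym (ccw-kept p p≢pe))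
                  (trans (sym (not-involutive _)) (cong not (sym ccw-reversed))) nB′ nB

  x : Edge
  x = blocking σ′ B

  X : Face
  X = across B x

  x∈B : x ∈ faceEdges B
  x∈B = blocking∈ σ′ B

  e≢b : e ≢ blocking σ B
  e≢b eq = Forth.blockingPos≢flipped (sym (edgeAt-injective B pe _ (trans (sym e≡) (trans eq (blocking≡edgeAt σ B)))))

  x≢e : x ≢ e
  x≢e eq = Back.blockingPos≢flipped (edgeAt-injective B _ pe (trans (sym (blocking≡edgeAt σ′ B)) (trans eq e≡)))

  x≢b : x ≢ blocking σ B
  x≢b eq = Forth.blockingPos-moves (edgeAt-injective B _ _
             (trans (sym (blocking≡edgeAt σ B)) (trans (sym eq) (blocking≡edgeAt σ′ B))))

  involving : ∀ F → involves fs σ F B ≡ true → F ≡ B ⊎ (F ≡ X × BlockedAt fs σ X x)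
  involving = involving-faces fs σ eo mA mB dA nB eA eB e≢b x∈B x≢e x≢b

  -- X is not adjacent to A, as X and A lie across different sides of B.
  X-off-A : ∀ y → y ∈ faceEdges X → y ∉ faceEdges A
  X-off-A y yX yA with shared-edge X A yX yA
  ... | inj₁ A≡X = x≢e (sym (across-injective B eB x∈B (trans (sym A≡) A≡X)))
  ... | inj₂ A≡ˣ = not-¬ refl (begin
    isUp B                    ≡⟨ sym (not-involutive _) ⟩
    not (not (isUp B))        ≡⟨ cong not (sym (isUp-across B x∈B)) ⟩
    not (isUp X)              ≡⟨ sym (isUp-across X yX) ⟩
    isUp (across X y)         ≡⟨ cong isUp (sym A≡ˣ) ⟩
    isUp A                    ≡⟨ cong isUp A≡ ⟩
    isUp (across B e)         ≡⟨ isUp-across B eB ⟩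
    not (isUp B)              ∎)
    where open ≡-Reasoning

  -- If σ blocks X towards B, then so does σ′, while σ′ blocks B towards X: a 2-cycle in σ′.
  blocked-X-stuck : BlockedAt fs σ X x → isDirected σ′ X ≡ false × tower fs σ′ B ≡ nothing × tower fs σ′ X ≡ nothing
  blocked-X-stuck (mX , nX , bX) =
    nX′ , two-cycle⇒tower≡nothing {fs} {σ′} {B} {X} nB′ nX′ refl X→B , two-cycle⇒tower≡nothing {fs} {σ′} {X} {B} nX′ nB′ X→B refl
    where
    same : AgreeOn X σ′ σ
    same y yX = off-A y (∈GEdges mX yX) (X-off-A y yX)
    nX′ : isDirected σ′ X ≡ false
    nX′ = trans (isDirected-cong {σ′} {σ} {X} same) nX
    X→B : nextFace σ′ X ≡ B
    X→B = trans (cong (across X) (trans (blocking-cong {σ′} {σ} {X} same) bX)) (across-involutive B x∈B)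

  Xs : List Face
  Xs = optional (blockedAt? fs σ X x) X

  -- Chain σ′ moves at B only if σ does not block X towards B, and chain σ moves at X only if it does.
  costs-≤-⅓ : cost fs σ′ B ℚ.+ sumℚ (map (λ F → cost fs σ F ℚ.+ cost fs σ′ F) Xs) ≤ ⅓
  costs-≤-⅓ = for (blockedAt? fs σ X x)
    where
    open ℚP.≤-Reasoning
    for : (D : Dec (BlockedAt fs σ X x)) → cost fs σ′ B ℚ.+ sumℚ (map (λ F → cost fs σ F ℚ.+ cost fs σ′ F) (optional D X)) ≤ ⅓
    for (no _) = subst (_≤ ⅓) (sym (ℚP.+-identityʳ (cost fs σ′ B))) (cost-≤-⅓ fs σ′ B nB′)
    for (yes bl@(_ , nX , _)) = stuck-at-B-and-X (blocked-X-stuck bl)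
      where
      stuck-at-B-and-X : isDirected σ′ X ≡ false × tower fs σ′ B ≡ nothing × tower fs σ′ X ≡ nothing →
                         cost fs σ′ B ℚ.+ ((cost fs σ X ℚ.+ cost fs σ′ X) ℚ.+ 0ℚ) ≤ ⅓
      stuck-at-B-and-X (nX′ , tB , tX) = begin
        cost fs σ′ B ℚ.+ ((cost fs σ X ℚ.+ cost fs σ′ X) ℚ.+ 0ℚ)
          ≡⟨ cong₂ (λ a b → a ℚ.+ ((cost fs σ X ℚ.+ b) ℚ.+ 0ℚ)) (cost-stuck fs σ′ B nB′ tB) (cost-stuck fs σ′ X nX′ tX) ⟩
        0ℚ ℚ.+ ((cost fs σ X ℚ.+ 0ℚ) ℚ.+ 0ℚ)
          ≡⟨ only-middle (cost fs σ X) ⟩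
        cost fs σ X
          ≤⟨ cost-≤-⅓ fs σ X nX ⟩
        ⅓ ∎

module TwoChains {fs : List Face} {σ₁ σ₂ : Ori} (eo₁ : IsEO fs σ₁) (eo₂ : IsEO fs σ₂)
  {A B : Face} {e : Edge} (mA : A ∈ fs) (dA₁ : isDirected σ₁ A ≡ true) (ag : Agree fs σ₂ (reverseFaces (A ∷ []) σ₁))
  (mB : B ∈ fs) (B≢A : B ≢ A) (eA : e ∈ faceEdges A) (eB : e ∈ faceEdges B)
  (nB₁ : isDirected σ₁ B ≡ false) (nB₂ : isDirected σ₂ B ≡ false) where

  on-A : ∀ y → y ∈ faceEdges A → σ₂ y ≡ not (σ₁ y)
  on-A y m = trans (ag y (∈GEdges mA m)) (reverseFace-∈ A σ₁ m)

  off-A : ∀ y → y ∈ GEdges fs → y ∉ faceEdges A → σ₂ y ≡ σ₁ y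
  off-A y g m = trans (ag y g) (reverseFace-∉ A σ₁ m)

  dA₂ : isDirected σ₂ A ≡ true
  dA₂ = trans (isDirected-cong {σ₂} {reverseFace A σ₁} {A} (Agree⇒AgreeOn {fs} mA ag))
              (trans (isDirected-reverseFace A σ₁) dA₁)

  module N₁ = Neighbours eo₁ eo₂ mA mB B≢A eA eB dA₁ nB₁ nB₂ on-A off-A
  module N₂ = Neighbours eo₂ eo₁ mA mB B≢A eA eB dA₂ nB₂ nB₁
                (λ y m → trans (sym (not-involutive _)) (cong not (sym (on-A y m)))) (λ y g m → sym (off-A y g m))

  candidates : List Face
  candidates = B ∷ N₁.Xs ++ N₂.Xs

  costs : Face → ℚ
  costs F = cost fs σ₁ F ℚ.+ cost fs σ₂ F

  involved⇒candidate : ∀ {F} → F ∈ fs → Involved fs σ₁ σ₂ A B F → F ∈ candidates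
  involved⇒candidate {F} _ (_ , inj₁ i) with N₁.involving F i
  ... | inj₁ refl = here refl
  ... | inj₂ (refl , bl) = there (∈-++⁺ˡ (∈-optional (blockedAt? fs σ₁ N₁.X N₁.x) bl))
  involved⇒candidate {F} _ (_ , inj₂ i) with N₂.involving F i
  ... | inj₁ refl = here refl
  ... | inj₂ (refl , bl) = there (∈-++⁺ʳ N₁.Xs (∈-optional (blockedAt? fs σ₂ N₂.X N₂.x) bl))

  candidate-costs-≤-⅔ : sumℚ (map costs candidates) ≤ ⅓ ℚ.+ ⅓
  candidate-costs-≤-⅔ = begin
    costs B ℚ.+ sumℚ (map costs (N₁.Xs ++ N₂.Xs))    ≡⟨ cong (costs B ℚ.+_) (sumℚ-++ costs N₁.Xs N₂.Xs) ⟩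
    costs B ℚ.+ (Σ₁ ℚ.+ sumℚ (map costs N₂.Xs))     ≡⟨ cong (λ s → costs B ℚ.+ (Σ₁ ℚ.+ s)) (sumℚ-cong swap N₂.Xs) ⟩
    costs B ℚ.+ (Σ₁ ℚ.+ Σ₂)                         ≡⟨ interchange (cost fs σ₁ B) (cost fs σ₂ B) Σ₁ Σ₂ ⟩
    (cost fs σ₂ B ℚ.+ Σ₁) ℚ.+ (cost fs σ₁ B ℚ.+ Σ₂) ≤⟨ ℚP.+-mono-≤ N₁.costs-≤-⅓ N₂.costs-≤-⅓ ⟩
    ⅓ ℚ.+ ⅓                                         ∎
    where
    open ℚP.≤-Reasoning
    Σ₁ = sumℚ (map costs N₁.Xs)
    Σ₂ = sumℚ (map (λ F → cost fs σ₂ F ℚ.+ cost fs σ₁ F) N₂.Xs)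
    swap : ∀ F → costs F ≡ cost fs σ₂ F ℚ.+ cost fs σ₁ F
    swap F = ℚP.+-comm (cost fs σ₁ F) (cost fs σ₂ F)

lemma8 : (C : List V) (fs : List Face) → SolidFaces C fs → Eulerian fs →
         (d : Ori → Ori → ℕ) → IsDistance fs d →
         (σ₁ σ₂ : Ori) → IsEO fs σ₁ → IsEO fs σ₂ →
         (A : Face) → A ∈ fs → isDirected σ₁ A ≡ true →
         Agree fs σ₂ (reverseFaces (A ∷ []) σ₁) →
         (B : Face) → B ∈ fs → B ≢ A →
         (∃ λ e → (e ∈ faceEdges A) × (e ∈ faceEdges B)) →
         isDirected σ₁ B ≡ false → isDirected σ₂ B ≡ false →
         expectedδB fs d σ₁ σ₂ A B ≤ inv (3 * length fs)
lemma8 _ fs solid _ d dist σ₁ σ₂ eo₁ eo₂ A mA dA₁ ag B mB B≢A (e , eA , eB) nB₁ nB₂ = begin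
  expectedδB fs d σ₁ σ₂ A B
    ≤⟨ expectedδB-≤-costs dist (SolidFaces.distinct solid) eo₁ eo₂ candidates involved⇒candidate ⟩
  inv (2 * length fs) ℚ.* sumℚ (map costs candidates)
    ≤⟨ ℚP.*-monoˡ-≤-nonNeg (inv (2 * length fs)) {{ℚ.nonNegative (inv-nonNeg (2 * length fs))}} candidate-costs-≤-⅔ ⟩
  inv (2 * length fs) ℚ.* (⅓ ℚ.+ ⅓)
    ≡⟨ inv[2n]*⅔≡inv[3n] (length fs) ⟩
  inv (3 * length fs) ∎
  where
  open ℚP.≤-Reasoning
  open TwoChains eo₁ eo₂ mA dA₁ ag mB B≢A eA eB nB₁ nB₂
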